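{- Let $G$ be a finite simple ISK4-free graph. Let $P$ be an appendix of a wheel $(H,x)$ of $G$, and let $H'_P$ be a sector of $H$ with respect to $P$. Then $H'_P$ contains at least three neighbors of $x$. In particular, $H'_P$ contains at least two sectors of $(H,x)$.
   Context: An ISK4 is an induced subgraph that is a subdivision of $K_4$. A hole is a chordless cycle of length at least 4. A wheel $(H,x)$ of $G$ is an induced subgraph consisting of a hole $H$ and a vertex $x\notin V(H)$ with at least three neighbors on $H$; a sector of $(H,x)$ is a subpath of $H$ whose ends are adjacent to $x$ and whose interior vertices are not. For a hole $H$, a chordless path $P=p_1\dots p_k$ in $G\setminus V(H)$ is an appendix of $H$ if no vertex of $P\setminus\{p_1,p_k\}$ has a neighbor in $H$ and either (i) $k=1$, $N(p_1)\cap V(H)=\{u_1,u_2\}$ with $u_1u_2$ not an edge, or (ii) $k>1$, $N(p_1)\cap V(H)=\{u_1\}$, $N(p_k)\cap V(H)=\{u_2\}$, $u_1\ne u_2$; the two $u_1u_2$-subpaths of $H$ are the sectors of $H$ w.r.t. $P$. $P$ is an appendix of the wheel $(H,x)$ if $P$ is an appendix of $H$, each of the two sectors of $H$ w.r.t. $P$ properly contains a sector of $(H,x)$, and $x$ has at most one neighbor in $P$. -}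

module Defs where

open import Data.Nat using (ℕ; zero; suc; _+_; _≤_; _<_; NonZero)
open import Data.Nat.DivMod using (_mod_)
open import Data.Fin using (Fin; toℕ; inject₁) renaming (zero to fzero; suc to fsuc)
open import Data.Product using (Σ; ∃; ∃-syntax; _×_; _,_)
open import Data.Sum using (_⊎_)
open import Relation.Nullary using (¬_; Dec)
open import Relation.Binary.PropositionalEquality using (_≡_; _≢_)
open import Function.Bundles using (_⇔_)

record Graph : Set₁ where
  field
    n        : ℕ
    E        : Fin n → Fin n → Set
    E-sym    : ∀ {u v} → E u v → E v u
    E-irrefl : ∀ {u} → ¬ E u u
    E-dec    : ∀ u v → Dec (E u v)

-- The six edges of K4 on branch set Fin 4

k4-end₁ k4-end₂ : Fin 6 → Fin 4
k4-end₁ fzero = fzero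
k4-end₁ (fsuc fzero) = fzero
k4-end₁ (fsuc (fsuc fzero)) = fzero
k4-end₁ (fsuc (fsuc (fsuc fzero))) = fsuc fzero
k4-end₁ (fsuc (fsuc (fsuc (fsuc fzero)))) = fsuc fzero
k4-end₁ (fsuc (fsuc (fsuc (fsuc (fsuc fzero))))) = fsuc (fsuc fzero)
k4-end₂ fzero = fsuc fzero
k4-end₂ (fsuc fzero) = fsuc (fsuc fzero)
k4-end₂ (fsuc (fsuc fzero)) = fsuc (fsuc (fsuc fzero))
k4-end₂ (fsuc (fsuc (fsuc fzero))) = fsuc (fsuc fzero)
k4-end₂ (fsuc (fsuc (fsuc (fsuc fzero)))) = fsuc (fsuc (fsuc fzero))
k4-end₂ (fsuc (fsuc (fsuc (fsuc (fsuc fzero))))) = fsuc (fsuc (fsuc fzero))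

CycAdj : (n : ℕ) .{{_ : NonZero n}} → Fin n → Fin n → Set
CycAdj n i j = (suc (toℕ i) mod n ≡ j) ⊎ (suc (toℕ j) mod n ≡ i)

module _ (G : Graph) where
  open Graph G

  Vtx : Set
  Vtx = Fin n

  record GPath : Set where
    field
      len    : ℕ
      vtx    : Fin (suc len) → Vtx
      inj    : ∀ s t → vtx s ≡ vtx t → s ≡ t
      consec : ∀ (a : Fin len) → E (vtx (inject₁ a)) (vtx (fsuc a))

  -- An ISK4: an induced subgraph of G which is a subdivision of K4.
  record ISK4 : Set where
    field
      br        : Fin 4 → Vtx
      br-inj    : ∀ i j → br i ≡ br j → i ≡ j
      path      : Fin 6 → GPath
      path-start : ∀ e → GPath.vtx (path e) fzero ≡ br (k4-end₁ e)
      path-end  : ∀ e → GPath.vtx (path e) (Data.Fin.fromℕ (GPath.len (path e)))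
                        ≡ br (k4-end₂ e)
      interior-private : ∀ e f (s : Fin (suc (GPath.len (path e)))) t →
                  0 < toℕ s → toℕ s < GPath.len (path e) →
                  GPath.vtx (path e) s ≡ GPath.vtx (path f) t → e ≡ f
      induced   : ∀ e f s t →
                  E (GPath.vtx (path e) s) (GPath.vtx (path f) t) →
                  ∃[ g ] ∃[ a ]
                    ((GPath.vtx (path g) (inject₁ a) ≡ GPath.vtx (path e) s ×
                      GPath.vtx (path g) (fsuc a) ≡ GPath.vtx (path f) t) ⊎
                     (GPath.vtx (path g) (inject₁ a) ≡ GPath.vtx (path f) t ×
                      GPath.vtx (path g) (fsuc a) ≡ GPath.vtx (path e) s))

  ISK4-free : Set
  ISK4-free = ¬ ISK4

  record Hole : Set where
    field
      k     : ℕ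
      h     : Fin (4 + k) → Vtx
      h-inj : ∀ i j → h i ≡ h j → i ≡ j
      h-adj : ∀ i j → E (h i) (h j) ⇔ CycAdj (4 + k) i j

  module _ (H : Hole) where
    open Hole H

    pos : Fin (4 + k) → ℕ → Vtx
    pos a t = h ((toℕ a + t) mod (4 + k))

    -- Subpaths of H: start, start+1, …, start+m (indices mod |H|),
    -- with 1 ≤ m < |H| (so the m+1 vertices are distinct).
    record SubPath : Set where
      field
        start : Fin (4 + k)
        m     : ℕ
        m≥1   : 1 ≤ m
        m<len : m < 4 + k

    module _ (S : SubPath) where
      open SubPath S
      spV : ℕ → Vtx
      spV t = pos start t
      first last : Vtx
      first = spV 0
      last  = spV m
      InSub : Vtx → Set
      InSub v = ∃[ t ] (t ≤ m × spV t ≡ v)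

    _⊆ₛ_ : SubPath → SubPath → Set
    S ⊆ₛ T = ∀ v → InSub S v → InSub T v

    _⊂ₛ_ : SubPath → SubPath → Set
    S ⊂ₛ T = S ⊆ₛ T × ∃[ v ] (InSub T v × ¬ InSub S v)

    record Appendix : Set where
      field
        k'      : ℕ
        p       : Fin (suc k') → Vtx
        p-inj   : ∀ i j → p i ≡ p j → i ≡ j
        p-chordless : ∀ i j → E (p i) (p j) ⇔
                        (suc (toℕ i) ≡ toℕ j ⊎ suc (toℕ j) ≡ toℕ i)
        p-offH  : ∀ i t → p i ≢ h t
        p-interior : ∀ (i : Fin (suc k')) → 0 < toℕ i → toℕ i < k' →
                       ∀ t → ¬ E (p i) (h t)
        i₁ i₂   : Fin (4 + k)
        i₁≢i₂   : i₁ ≢ i₂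
        attach  :
          (k' ≡ 0 ×
            (∀ t → E (p fzero) (h t) ⇔ (t ≡ i₁ ⊎ t ≡ i₂)) ×
            ¬ E (h i₁) (h i₂))
          ⊎
          (1 ≤ k' ×
            (∀ t → E (p fzero) (h t) ⇔ t ≡ i₁) ×
            (∀ t → E (p (Data.Fin.fromℕ k')) (h t) ⇔ t ≡ i₂))

    SectorWrt : Appendix → SubPath → Set
    SectorWrt P S =
      (first S ≡ h (Appendix.i₁ P) × last S ≡ h (Appendix.i₂ P)) ⊎
      (first S ≡ h (Appendix.i₂ P) × last S ≡ h (Appendix.i₁ P))

  record Wheel : Set where
    field
      hole : Hole
      x    : Vtx
      x∉H  : ∀ i → Hole.h hole i ≢ x
      three-nbrs : ∃[ i ] ∃[ j ] ∃[ l ]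
                     (i ≢ j × i ≢ l × j ≢ l ×
                      E x (Hole.h hole i) × E x (Hole.h hole j) × E x (Hole.h hole l))

  module _ (W : Wheel) where
    open Wheel W

    IsSector : SubPath hole → Set
    IsSector S = E x (first hole S) × E x (last hole S) ×
                 (∀ t → 0 < t → t < SubPath.m S → ¬ E x (spV hole S t))

    IsWheelAppendix : Appendix hole → Set
    IsWheelAppendix P =
      (∀ S → SectorWrt hole P S → ∃[ T ] (IsSector T × _⊂ₛ_ hole T S)) ×
      (∀ i j → E x (Appendix.p P i) → E x (Appendix.p P j) → i ≡ j)

-- Read the hole H from one end of S, so that S = c 0 … c m, and run the appendix from c m back
-- to c 0; S followed by the appendix is again a hole. The sector of (H, x) inside S gives two
-- neighbours of x on S. If they were the only ones, x would see some c γ outside S, and an ISK4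
-- would appear: a vertex with exactly three neighbours on a hole if x sees the appendix or sees
-- nothing but c γ outside S; otherwise the path from x through its first neighbour after c m
-- back to c m, or (when c m is itself a neighbour, so that c 0 is not) through its last neighbour
-- before c 0 on to c 0, is a fourth branch attached to the hole S + appendix. Three consecutive
-- neighbours of x on S then bound two sectors inside S.
module Submission where

open import Defs
open import Data.Nat
open import Data.Nat.Properties
open import Data.Nat.DivMod
open import Data.Fin using (Fin; toℕ; inject₁; fromℕ; fromℕ<) renaming (zero to fzero; suc to fsuc)
open import Data.Fin.Properties using (toℕ-inject₁; toℕ-fromℕ; toℕ-fromℕ<; toℕ-injective; toℕ<n)
open import Data.Product
open import Data.Sum using (_⊎_; inj₁; inj₂; [_,_]′) renaming (map to ⊎-map; map₂ to ⊎-map₂)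
open import Data.Empty
open import Data.Unit using (⊤; tt)
open import Relation.Nullary
open import Relation.Binary.PropositionalEquality
open import Relation.Binary.Definitions using (tri<; tri≈; tri>)
open import Function.Bundles using (Equivalence)

0<n≤m⇒m∸n<m : ∀ {m n} → 0 < n → n ≤ m → m ∸ n < m
0<n≤m⇒m∸n<m {m} {n} 0<n n≤m = ∸-monoʳ-< {m} {n} {0} 0<n n≤m

1+[m∸[1+n]]≡m∸n : ∀ m n → n < m → suc (m ∸ suc n) ≡ m ∸ n
1+[m∸[1+n]]≡m∸n m n n<m = sym (+-∸-assoc 1 n<m)

n≤o∸m⇒m+n≤o : ∀ {m o} n → m ≤ o → n ≤ o ∸ m → m + n ≤ o
n≤o∸m⇒m+n≤o {m} n m≤o n≤ = subst (m + n ≤_) (m+[n∸m]≡n m≤o) (+-monoʳ-≤ m n≤)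

n<o∸m⇒m+n<o : ∀ {m o} n → m ≤ o → n < o ∸ m → m + n < o
n<o∸m⇒m+n<o {m} n m≤o n< = subst (m + n <_) (m+[n∸m]≡n m≤o) (+-monoʳ-< m n<)

1+[m∸n]≡m∸o⇒1+o≡n : ∀ m n o → n ≤ m → o ≤ m → suc (m ∸ n) ≡ m ∸ o → suc o ≡ n
1+[m∸n]≡m∸o⇒1+o≡n m n o n≤m o≤m eq = +-cancelˡ-≡ (m ∸ n) (suc o) n (begin
  m ∸ n + suc o   ≡⟨ +-suc (m ∸ n) o ⟩
  suc (m ∸ n) + o ≡⟨ cong (_+ o) eq ⟩
  m ∸ o + o       ≡⟨ m∸n+n≡m o≤m ⟩
  m               ≡⟨ sym (m∸n+n≡m n≤m) ⟩
  m ∸ n + n       ∎)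
  where open ≡-Reasoning

m∸n≡m⇒n≡0 : ∀ {m n} → n ≤ m → m ∸ n ≡ m → n ≡ 0
m∸n≡m⇒n≡0 n≤m eq = ∸-cancelˡ-≡ n≤m z≤n eq

m∸n≡0⇒n≡m : ∀ {m n} → n ≤ m → m ∸ n ≡ 0 → n ≡ m
m∸n≡0⇒n≡m {m} n≤m eq = ∸-cancelˡ-≡ n≤m ≤-refl (trans eq (sym (n∸n≡0 m)))

module Modulo (L' : ℕ) where

  L : ℕ
  L = suc L'

  [m+n]%L≡m+n∸L : ∀ a b → a < L → b < L → L ≤ a + b → (a + b) % L ≡ a + b ∸ L
  [m+n]%L≡m+n∸L a b a<L b<L L≤a+b = begin
    (a + b) % L         ≡⟨ cong (_% L) (sym (m∸n+n≡m L≤a+b)) ⟩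
    (a + b ∸ L + L) % L ≡⟨ [m+n]%n≡m%n (a + b ∸ L) L ⟩
    (a + b ∸ L) % L     ≡⟨ m<n⇒m%n≡m reduced<L ⟩
    a + b ∸ L           ∎
    where
      open ≡-Reasoning
      reduced<L : a + b ∸ L < L
      reduced<L = subst (a + b ∸ L <_) (m+n∸n≡m L L) (∸-monoˡ-< (+-mono-< a<L b<L) L≤a+b)

  a+s≢a+t∸L : ∀ a s t → t < L → L ≤ a + t → a + s ≢ a + t ∸ L
  a+s≢a+t∸L a s t t<L L≤ e = <-irrefl (sym e) (<-≤-trans lt (m≤m+n a s))
    where lt = subst (a + t ∸ L <_) (m+n∸n≡m a L) (∸-monoˡ-< (+-monoʳ-< a t<L) L≤)

  +-%-cancelˡ : ∀ a s t → a < L → s < L → t < L → (a + s) % L ≡ (a + t) % L → s ≡ t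
  +-%-cancelˡ a s t a<L s<L t<L eq with (a + s) <? L | (a + t) <? L
  ... | yes p | yes q = +-cancelˡ-≡ a s t (trans (sym (m<n⇒m%n≡m p)) (trans eq (m<n⇒m%n≡m q)))
  ... | no ¬p | no ¬q = +-cancelˡ-≡ a s t (∸-cancelʳ-≡ (≮⇒≥ ¬p) (≮⇒≥ ¬q)
        (trans (sym ([m+n]%L≡m+n∸L a s a<L s<L (≮⇒≥ ¬p))) (trans eq ([m+n]%L≡m+n∸L a t a<L t<L (≮⇒≥ ¬q)))))
  ... | yes p | no ¬q = ⊥-elim (a+s≢a+t∸L a s t t<L (≮⇒≥ ¬q)
        (trans (sym (m<n⇒m%n≡m p)) (trans eq ([m+n]%L≡m+n∸L a t a<L t<L (≮⇒≥ ¬q)))))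
  ... | no ¬p | yes q = ⊥-elim (a+s≢a+t∸L a t s s<L (≮⇒≥ ¬p)
        (trans (sym (m<n⇒m%n≡m q)) (trans (sym eq) ([m+n]%L≡m+n∸L a s a<L s<L (≮⇒≥ ¬p)))))

  1+[m%L]%L≡[1+m]%L : ∀ u → suc (u % L) % L ≡ suc u % L
  1+[m%L]%L≡[1+m]%L u = begin
    (1 + u % L) % L             ≡⟨ %-distribˡ-+ 1 (u % L) L ⟩
    (1 % L + u % L % L) % L     ≡⟨ cong (λ v → (1 % L + v) % L) (m%n%n≡m%n u L) ⟩
    (1 % L + u % L) % L         ≡⟨ sym (%-distribˡ-+ 1 u L) ⟩
    (1 + u) % L                 ∎
    where open ≡-Reasoning

  [m%L+n]%L≡[m+n]%L : ∀ u t → (u % L + t) % L ≡ (u + t) % L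
  [m%L+n]%L≡[m+n]%L u t = begin
    (u % L + t) % L             ≡⟨ %-distribˡ-+ (u % L) t L ⟩
    (u % L % L + t % L) % L     ≡⟨ cong (λ v → (v + t % L) % L) (m%n%n≡m%n u L) ⟩
    (u % L + t % L) % L         ≡⟨ sym (%-distribˡ-+ u t L) ⟩
    (u + t) % L                 ∎
    where open ≡-Reasoning

  [a+[u+L]]%L≡[a+u]%L : ∀ a u → (a + (u + L)) % L ≡ (a + u) % L
  [a+[u+L]]%L≡[a+u]%L a u = trans (cong (_% L) (sym (+-assoc a u L))) ([m+n]%n≡m%n (a + u) L)

  rebase-offset : ∀ a σ → a < L → σ < L → Σ ℕ λ τ → τ < L × (∀ t → (a + t) % L ≡ (σ + (τ + t)) % L)
  rebase-offset a σ a<L σ<L with σ ≤? a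
  ... | yes σ≤a = a ∸ σ , ≤-<-trans (m∸n≤m a σ) a<L ,
        λ t → cong (_% L) (sym (trans (sym (+-assoc σ (a ∸ σ) t)) (cong (_+ t) (m+[n∸m]≡n σ≤a))))
  ... | no σ≰a = L ∸ σ + a , τ<L , λ t → trans (sym ([m+n]%n≡m%n (a + t) L)) (cong (_% L) (sym (wraps t)))
    where
      τ<L : L ∸ σ + a < L
      τ<L = subst (L ∸ σ + a <_) (m∸n+n≡m (<⇒≤ σ<L)) (+-monoʳ-< (L ∸ σ) (≰⇒> σ≰a))
      wraps : ∀ t → σ + ((L ∸ σ + a) + t) ≡ a + t + L
      wraps t = begin
        σ + ((L ∸ σ + a) + t) ≡⟨ sym (+-assoc σ (L ∸ σ + a) t) ⟩
        σ + (L ∸ σ + a) + t   ≡⟨ cong (_+ t) (sym (+-assoc σ (L ∸ σ) a)) ⟩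
        σ + (L ∸ σ) + a + t   ≡⟨ cong (λ v → v + a + t) (m+[n∸m]≡n (<⇒≤ σ<L)) ⟩
        L + a + t             ≡⟨ +-assoc L a t ⟩
        L + (a + t)           ≡⟨ +-comm L (a + t) ⟩
        a + t + L             ∎
        where open ≡-Reasoning

module BoundedSearch (P : ℕ → Set) (P? : ∀ t → Dec (P t)) where

  least : ∀ k → (Σ ℕ λ t → t < k × P t × (∀ t' → t' < t → ¬ P t')) ⊎ (∀ t → t < k → ¬ P t)
  least zero = inj₂ (λ t ())
  least (suc k) with least k
  ... | inj₁ (t , t<k , pt , below) = inj₁ (t , <-trans t<k (n<1+n k) , pt , below)
  ... | inj₂ none with P? k
  ...   | yes pk = inj₁ (k , n<1+n k , pk , none)
  ...   | no ¬pk = inj₂ (λ t t< → [ none t , (λ { refl → ¬pk }) ]′ (m<1+n⇒m<n∨m≡n t<))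

  greatest : ∀ k → (Σ ℕ λ t → t < k × P t × (∀ t' → t < t' → t' < k → ¬ P t')) ⊎ (∀ t → t < k → ¬ P t)
  greatest zero = inj₂ (λ t ())
  greatest (suc k) with P? k
  ... | yes pk = inj₁ (k , n<1+n k , pk , λ t' k<t' t'< → ⊥-elim (<-irrefl refl (<-≤-trans k<t' (≤-pred t'<))))
  ... | no ¬pk with greatest k
  ...   | inj₁ (t , t<k , pt , above) = inj₁ (t , <-trans t<k (n<1+n k) , pt ,
            λ t' t<t' t'< → [ above t' t<t' , (λ { refl → ¬pk }) ]′ (m<1+n⇒m<n∨m≡n t'<))
  ...   | inj₂ none = inj₂ (λ t t< → [ none t , (λ { refl → ¬pk }) ]′ (m<1+n⇒m<n∨m≡n t<))

clamp : ∀ K → ℕ → Fin (suc K)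
clamp K zero = fzero
clamp zero (suc j) = fzero
clamp (suc K) (suc j) = fsuc (clamp K j)

toℕ-clamp : ∀ K j → j ≤ K → toℕ (clamp K j) ≡ j
toℕ-clamp K zero _ = refl
toℕ-clamp (suc K) (suc j) (s≤s j≤) = cong suc (toℕ-clamp K j j≤)

clamp-inj : ∀ K j j' → j ≤ K → j' ≤ K → clamp K j ≡ clamp K j' → j ≡ j'
clamp-inj K j j' j≤ j'≤ e = trans (sym (toℕ-clamp K j j≤)) (trans (cong toℕ e) (toℕ-clamp K j' j'≤))

clamp-top : ∀ K → clamp K K ≡ fromℕ K
clamp-top K = toℕ-injective (trans (toℕ-clamp K K ≤-refl) (sym (toℕ-fromℕ K)))

pigeonhole₂ : ∀ {A : Set} {a b x y z : A} → x ≡ a ⊎ x ≡ b → y ≡ a ⊎ y ≡ b → z ≡ a ⊎ z ≡ b →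
              x ≢ y → x ≢ z → y ≢ z → ⊥
pigeonhole₂ (inj₁ refl) (inj₁ refl) _ x≢y _ _ = x≢y refl
pigeonhole₂ (inj₁ refl) (inj₂ refl) (inj₁ refl) _ x≢z _ = x≢z refl
pigeonhole₂ (inj₁ refl) (inj₂ refl) (inj₂ refl) _ _ y≢z = y≢z refl
pigeonhole₂ (inj₂ refl) (inj₂ refl) _ x≢y _ _ = x≢y refl
pigeonhole₂ (inj₂ refl) (inj₁ refl) (inj₂ refl) _ x≢z _ = x≢z refl
pigeonhole₂ (inj₂ refl) (inj₁ refl) (inj₁ refl) _ _ y≢z = y≢z refl

CycAdjℕ : ℕ → ℕ → ℕ → Set
CycAdjℕ N s t = (suc s ≡ t) ⊎ (suc t ≡ s) ⊎ (s ≡ 0 × suc t ≡ N) ⊎ (t ≡ 0 × suc s ≡ N)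

CycAdjℕ-sym : ∀ {N s t} → CycAdjℕ N s t → CycAdjℕ N t s
CycAdjℕ-sym (inj₁ e) = inj₂ (inj₁ e)
CycAdjℕ-sym (inj₂ (inj₁ e)) = inj₁ e
CycAdjℕ-sym (inj₂ (inj₂ (inj₁ e))) = inj₂ (inj₂ (inj₂ e))
CycAdjℕ-sym (inj₂ (inj₂ (inj₂ e))) = inj₂ (inj₂ (inj₁ e))

module _ (G : Graph) where
  open Graph G

  -- Holes and chordless paths of G, indexed by ℕ and read only below their length.
  record IsCycle (N : ℕ) (w : ℕ → Fin n) : Set where
    field
      inj  : ∀ s t → s < N → t < N → w s ≡ w t → s ≡ t
      adj⇒ : ∀ s t → s < N → t < N → E (w s) (w t) → CycAdjℕ N s t
      ⇒adj : ∀ s t → s < N → t < N → CycAdjℕ N s t → E (w s) (w t)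

  record IsChordlessPath (f : ℕ → Fin n) (M : ℕ) : Set where
    field
      inj  : ∀ s t → s ≤ M → t ≤ M → f s ≡ f t → s ≡ t
      adj⇒ : ∀ s t → s ≤ M → t ≤ M → E (f s) (f t) → suc s ≡ t ⊎ suc t ≡ s
      step : ∀ s → s < M → E (f s) (f (suc s))

  reverse : ∀ {f M} → IsChordlessPath f M → IsChordlessPath (λ t → f (M ∸ t)) M
  reverse {f} {M} P = record
    { inj  = λ s t s≤ t≤ eq → ∸-cancelˡ-≡ s≤ t≤ (inj (M ∸ s) (M ∸ t) (m∸n≤m M s) (m∸n≤m M t) eq)
    ; adj⇒ = λ s t s≤ t≤ e →
        [ (λ eq → inj₂ (1+[m∸n]≡m∸o⇒1+o≡n M s t s≤ t≤ eq)) , (λ eq → inj₁ (1+[m∸n]≡m∸o⇒1+o≡n M t s t≤ s≤ eq)) ]′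
          (adj⇒ (M ∸ s) (M ∸ t) (m∸n≤m M s) (m∸n≤m M t) e)
    ; step = λ s s< → E-sym (subst (λ u → E (f (M ∸ suc s)) (f u)) (1+[m∸[1+n]]≡m∸n M s s<)
                        (step (M ∸ suc s) (0<n≤m⇒m∸n<m z<s s<)))
    }
    where open IsChordlessPath P

  module Concatenation (a b : ℕ → Fin n) (M K : ℕ) (A : IsChordlessPath a M) (B : IsChordlessPath b K)
      (a≢b : ∀ s j → s ≤ M → j ≤ K → a s ≢ b j)
      (a~b⇒ends : ∀ s j → s ≤ M → j ≤ K → E (a s) (b j) → (s ≡ M × j ≡ 0) ⊎ (s ≡ 0 × j ≡ K))
      (aM~b0 : E (a M) (b 0)) (a0~bK : E (a 0) (b K)) where
    private
      module A = IsChordlessPath A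
      module B = IsChordlessPath B

    N : ℕ
    N = suc M + suc K

    w : ℕ → Fin n
    w t with t ≤? M
    ... | yes _ = a t
    ... | no _  = b (t ∸ suc M)

    w-left : ∀ t → t ≤ M → w t ≡ a t
    w-left t t≤ with t ≤? M
    ... | yes _ = refl
    ... | no ¬p = ⊥-elim (¬p t≤)

    w-right : ∀ j → w (suc M + j) ≡ b j
    w-right j with suc M + j ≤? M
    ... | yes p = ⊥-elim (<-irrefl refl (≤-trans (m≤m+n (suc M) j) p))
    ... | no _  = cong b (m+n∸m≡n (suc M) j)

    data Side (t : ℕ) : Set where
      left  : t ≤ M → Side t
      right : ∀ j → j ≤ K → t ≡ suc M + j → Side t

    side : ∀ t → t < N → Side t
    side t t< with t ≤? M
    ... | yes p = left p
    ... | no ¬p = right (t ∸ suc M)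
                    (≤-pred (subst (t ∸ suc M <_) (m+n∸m≡n (suc M) (suc K)) (∸-monoˡ-< t< (≰⇒> ¬p))))
                    (sym (m+[n∸m]≡n (≰⇒> ¬p)))

    private
      w-inj : ∀ s t → s < N → t < N → w s ≡ w t → s ≡ t
      w-inj s t s< t< eq with side s s< | side t t<
      ... | left p | left q = A.inj s t p q (trans (sym (w-left s p)) (trans eq (w-left t q)))
      ... | right j j≤ refl | right j' j'≤ refl =
            cong (suc M +_) (B.inj j j' j≤ j'≤ (trans (sym (w-right j)) (trans eq (w-right j'))))
      ... | left p | right j' j'≤ refl = ⊥-elim (a≢b s j' p j'≤ (trans (sym (w-left s p)) (trans eq (w-right j'))))
      ... | right j j≤ refl | left q = ⊥-elim (a≢b t j q j≤ (trans (sym (w-left t q)) (trans (sym eq) (w-right j))))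

      link : ∀ s j → s ≤ M → j ≤ K → E (a s) (b j) → CycAdjℕ N s (suc M + j)
      link s j s≤ j≤ e with a~b⇒ends s j s≤ j≤ e
      ... | inj₁ (refl , refl) = inj₁ (sym (+-identityʳ (suc s)))
      ... | inj₂ (refl , refl) = inj₂ (inj₂ (inj₁ (refl , cong suc (sym (+-suc M K)))))

      w-adj⇒ : ∀ s t → s < N → t < N → E (w s) (w t) → CycAdjℕ N s t
      w-adj⇒ s t s< t< e with side s s< | side t t<
      ... | left p | left q = [ inj₁ , (λ eq → inj₂ (inj₁ eq)) ]′ (A.adj⇒ s t p q (subst₂ E (w-left s p) (w-left t q) e))
      ... | right j j≤ refl | right j' j'≤ refl with B.adj⇒ j j' j≤ j'≤ (subst₂ E (w-right j) (w-right j') e)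
      ...   | inj₁ refl = inj₁ (sym (+-suc (suc M) j))
      ...   | inj₂ refl = inj₂ (inj₁ (sym (+-suc (suc M) j')))
      w-adj⇒ s t s< t< e | left p | right j' j'≤ refl = link s j' p j'≤ (subst₂ E (w-left s p) (w-right j') e)
      w-adj⇒ s t s< t< e | right j j≤ refl | left q =
        CycAdjℕ-sym (link t j q j≤ (subst₂ E (w-left t q) (w-right j) (E-sym e)))

      w-step : ∀ s → suc s < N → E (w s) (w (suc s))
      w-step s s< with side s (<-trans (n<1+n s) s<)
      ... | left p with m≤n⇒m<n∨m≡n p
      ...   | inj₁ s<M = subst₂ E (sym (w-left s p)) (sym (w-left (suc s) s<M)) (A.step s s<M)
      ...   | inj₂ refl = subst₂ E (sym (w-left s p)) (trans (sym (w-right 0)) (cong w (+-identityʳ (suc s)))) aM~b0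
      w-step s s< | right j j≤ refl =
        subst₂ E (sym (w-right j)) (trans (sym (w-right (suc j))) (cong w (+-suc (suc M) j)))
          (B.step j (≤-pred (+-cancelˡ-< (suc M) (suc j) (suc K) (subst (_< N) (sym (+-suc (suc M) j)) s<))))

      w-last≡bK : ∀ t → suc t ≡ N → w t ≡ b K
      w-last≡bK t eq = trans (cong w (suc-injective (trans eq (cong suc (+-suc M K))))) (w-right K)

      w-⇒adj : ∀ s t → s < N → t < N → CycAdjℕ N s t → E (w s) (w t)
      w-⇒adj s t s< t< (inj₁ refl) = w-step s t<
      w-⇒adj s t s< t< (inj₂ (inj₁ refl)) = E-sym (w-step t s<)
      w-⇒adj s t s< t< (inj₂ (inj₂ (inj₁ (refl , e)))) = subst₂ E (sym (w-left 0 z≤n)) (sym (w-last≡bK t e)) a0~bK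
      w-⇒adj s t s< t< (inj₂ (inj₂ (inj₂ (refl , e)))) = E-sym (subst₂ E (sym (w-left 0 z≤n)) (sym (w-last≡bK s e)) a0~bK)

    w-isCycle : IsCycle N w
    w-isCycle = record { inj = w-inj ; adj⇒ = w-adj⇒ ; ⇒adj = w-⇒adj }

  -- A hole w, a vertex z whose neighbours on it are w i, w j (and w l if ℓ = 1), and a chordless
  -- spoke sp from z to w l whose interior avoids the hole and touches it only at its last step:
  -- a subdivision of K4 with branch vertices z, w i, w j, w l.
  record SpokedCycle : Set where
    field
      N     : ℕ
      w     : ℕ → Fin n
      cycle : IsCycle N w
      z     : Fin n
      i j l : ℕ
      i<j   : i < j
      j<l   : j < l
      l<N   : l < N
      ℓ     : ℕ
      ℓ≥1   : 1 ≤ ℓ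
      z≢w   : ∀ s → s < N → z ≢ w s
      z~w⇒  : ∀ s → s < N → E z (w s) → s ≡ i ⊎ s ≡ j ⊎ (ℓ ≡ 1 × s ≡ l)
      z~wi  : E z (w i)
      z~wj  : E z (w j)
      sp    : ℕ → Fin n
      sp0   : sp 0 ≡ z
      spℓ   : sp ℓ ≡ w l
      spoke : IsChordlessPath sp ℓ
      sp≢w  : ∀ r s → 0 < r → r < ℓ → s < N → sp r ≢ w s
      sp~w⇒ : ∀ r s → 0 < r → r < ℓ → s < N → E (sp r) (w s) → suc r ≡ ℓ × s ≡ l

  pattern zi = fzero
  pattern zj = fsuc fzero
  pattern zl = fsuc (fsuc fzero)
  pattern ij = fsuc (fsuc (fsuc fzero))
  pattern il = fsuc (fsuc (fsuc (fsuc fzero)))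
  pattern jl = fsuc (fsuc (fsuc (fsuc (fsuc fzero))))

  module SpokedCycleISK4 (D : SpokedCycle) where
    open SpokedCycle D
    open IsCycle cycle renaming (inj to w-inj; adj⇒ to w-adj⇒; ⇒adj to w-⇒adj)
    open IsChordlessPath spoke renaming (inj to sp-inj; adj⇒ to sp-adj⇒; step to sp-step)

    i<l : i < l
    i<l = <-trans i<j j<l
    j<N : j < N
    j<N = <-trans j<l l<N
    i<N : i < N
    i<N = <-trans i<l l<N

    data Loc : Set where
      atZ  : Loc
      atW  : ℕ → Loc
      atSp : ℕ → Loc

    ⟦_⟧ : Loc → Fin n
    ⟦ atZ ⟧ = z
    ⟦ atW p ⟧ = w p
    ⟦ atSp r ⟧ = sp r

    Valid : Loc → Set
    Valid atZ = ⊤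
    Valid (atW p) = p < N
    Valid (atSp r) = 0 < r × r < ℓ

    Branch : Loc → Set
    Branch atZ = ⊤
    Branch (atW p) = p ≡ i ⊎ p ≡ j ⊎ p ≡ l
    Branch (atSp _) = ⊥

    ⟦⟧-inj : ∀ a b → Valid a → Valid b → ⟦ a ⟧ ≡ ⟦ b ⟧ → a ≡ b
    ⟦⟧-inj atZ atZ _ _ _ = refl
    ⟦⟧-inj atZ (atW p) _ vb eq = ⊥-elim (z≢w p vb eq)
    ⟦⟧-inj atZ (atSp r) _ (0<r , r<ℓ) eq = ⊥-elim (<⇒≢ 0<r (sp-inj 0 r z≤n (<⇒≤ r<ℓ) (trans sp0 eq)))
    ⟦⟧-inj (atW p) atZ va _ eq = ⊥-elim (z≢w p va (sym eq))
    ⟦⟧-inj (atW p) (atW q) va vb eq = cong atW (w-inj p q va vb eq)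
    ⟦⟧-inj (atW p) (atSp r) va (0<r , r<ℓ) eq = ⊥-elim (sp≢w r p 0<r r<ℓ va (sym eq))
    ⟦⟧-inj (atSp r) atZ (0<r , r<ℓ) _ eq = ⊥-elim (<⇒≢ 0<r (sp-inj 0 r z≤n (<⇒≤ r<ℓ) (trans sp0 (sym eq))))
    ⟦⟧-inj (atSp r) (atW p) (0<r , r<ℓ) vb eq = ⊥-elim (sp≢w r p 0<r r<ℓ vb eq)
    ⟦⟧-inj (atSp r) (atSp r') (_ , r<ℓ) (_ , r'<ℓ) eq = cong atSp (sp-inj r r' (<⇒≤ r<ℓ) (<⇒≤ r'<ℓ) eq)

    spokeLoc : ℕ → Loc
    spokeLoc zero = atZ
    spokeLoc (suc r) with suc r <? ℓ
    ... | yes _ = atSp (suc r)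
    ... | no _  = atW l

    spokeLoc-interior : ∀ r → 0 < r → r < ℓ → spokeLoc r ≡ atSp r
    spokeLoc-interior (suc r) _ r<ℓ with suc r <? ℓ
    ... | yes _ = refl
    ... | no ¬p = ⊥-elim (¬p r<ℓ)

    spokeLoc-end : ∀ r → 0 < r → ¬ r < ℓ → spokeLoc r ≡ atW l
    spokeLoc-end (suc r) _ ¬p with suc r <? ℓ
    ... | yes p = ⊥-elim (¬p p)
    ... | no _  = refl

    ⟦spokeLoc⟧ : ∀ r → r ≤ ℓ → ⟦ spokeLoc r ⟧ ≡ sp r
    ⟦spokeLoc⟧ zero _ = sym sp0
    ⟦spokeLoc⟧ (suc r) r≤ℓ with suc r <? ℓ
    ... | yes _ = refl
    ... | no ¬p = trans (sym spℓ) (cong sp (sym (≤-antisym r≤ℓ (≮⇒≥ ¬p))))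

    spokeLoc-valid : ∀ r → r ≤ ℓ → Valid (spokeLoc r)
    spokeLoc-valid zero _ = tt
    spokeLoc-valid (suc r) _ with suc r <? ℓ
    ... | yes p = z<s , p
    ... | no _  = l<N

    -- The arc from w i down through w 0 and around to w l.
    back : ℕ → ℕ
    back t with t ≤? i
    ... | yes _ = i ∸ t
    ... | no _  = N + i ∸ t

    back-≤ : ∀ t → t ≤ i → back t ≡ i ∸ t
    back-≤ t t≤i with t ≤? i
    ... | yes _ = refl
    ... | no ¬p = ⊥-elim (¬p t≤i)

    back-> : ∀ t → i < t → back t ≡ N + i ∸ t
    back-> t i<t with t ≤? i
    ... | yes p = ⊥-elim (<-irrefl refl (<-≤-trans i<t p))
    ... | no _  = refl

    backLen : ℕ
    backLen = i + (N ∸ l)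

    backLen≤N+i : backLen ≤ N + i
    backLen≤N+i = subst (backLen ≤_) (+-comm i N) (+-monoʳ-≤ i (m∸n≤m N l))

    N+i∸backLen≡l : N + i ∸ backLen ≡ l
    N+i∸backLen≡l = trans (cong (_∸ backLen) (+-comm N i)) (trans ([m+n]∸[m+o]≡n∸o i N (N ∸ l)) (m∸[m∸n]≡n (<⇒≤ l<N)))

    i<backLen : i < backLen
    i<backLen = subst (_< backLen) (+-identityʳ i) (+-monoʳ-< i (m<n⇒0<n∸m l<N))

    l≤back : ∀ t → i < t → t ≤ backLen → l ≤ back t
    l≤back t i<t t≤ = subst (_≤ back t) N+i∸backLen≡l
      (subst (N + i ∸ backLen ≤_) (sym (back-> t i<t)) (∸-monoʳ-≤ (N + i) t≤))

    l<back : ∀ t → i < t → t < backLen → l < back t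
    l<back t i<t t< = subst (_< back t) N+i∸backLen≡l
      (subst (N + i ∸ backLen <_) (sym (back-> t i<t)) (∸-monoʳ-< t< backLen≤N+i))

    back<N : ∀ t → t ≤ backLen → back t < N
    back<N t t≤ with t ≤? i
    ... | yes p = ≤-<-trans (m∸n≤m i t) i<N
    ... | no ¬p = subst (N + i ∸ t <_) (m+n∸n≡m N i) (∸-monoʳ-< (≰⇒> ¬p) (≤-trans t≤ backLen≤N+i))

    back-inj : ∀ t t' → t ≤ backLen → t' ≤ backLen → back t ≡ back t' → t ≡ t'
    back-inj t t' t≤ t'≤ eq with t ≤? i | t' ≤? i
    ... | yes p | yes p' = ∸-cancelˡ-≡ p p' eq
    ... | no ¬p | no ¬p' = ∸-cancelˡ-≡ (≤-trans t≤ backLen≤N+i) (≤-trans t'≤ backLen≤N+i) eq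
    ... | yes p | no ¬p' = ⊥-elim (<-irrefl eq (<-≤-trans (≤-<-trans (m∸n≤m i t) i<l)
          (subst (l ≤_) (back-> t' (≰⇒> ¬p')) (l≤back t' (≰⇒> ¬p') t'≤))))
    ... | no ¬p | yes p' = ⊥-elim (<-irrefl (sym eq) (<-≤-trans (≤-<-trans (m∸n≤m i t') i<l)
          (subst (l ≤_) (back-> t (≰⇒> ¬p)) (l≤back t (≰⇒> ¬p) t≤))))

    back-step : ∀ t → t < backLen → CycAdjℕ N (back t) (back (suc t))
    back-step t t< with <-cmp t i
    ... | tri< t<i _ _ = inj₂ (inj₁ (trans (cong suc (back-≤ (suc t) t<i))
                           (trans (1+[m∸[1+n]]≡m∸n i t t<i) (sym (back-≤ t (<⇒≤ t<i))))))
    ... | tri≈ _ refl _ = inj₂ (inj₂ (inj₁ (trans (back-≤ t ≤-refl) (n∸n≡0 t) ,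
                            trans (cong suc (back-> (suc t) ≤-refl))
                              (trans (1+[m∸[1+n]]≡m∸n (N + t) t (<-≤-trans i<N (m≤m+n N t))) (m+n∸n≡m N t)))))
    ... | tri> _ _ i<t = inj₂ (inj₁ (trans (cong suc (back-> (suc t) (<-trans i<t (n<1+n t))))
                           (trans (1+[m∸[1+n]]≡m∸n (N + i) t (<-≤-trans t< backLen≤N+i)) (sym (back-> t i<t)))))

    len : Fin 6 → ℕ
    len zi = 1
    len zj = 1
    len zl = ℓ
    len ij = j ∸ i
    len il = backLen
    len jl = l ∸ j

    edgeFromZ : ℕ → ℕ → Loc
    edgeFromZ p zero = atZ
    edgeFromZ p (suc _) = atW p

    loc : Fin 6 → ℕ → Loc
    loc zi t = edgeFromZ i t
    loc zj t = edgeFromZ j t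
    loc zl t = spokeLoc t
    loc ij t = atW (i + t)
    loc il t = atW (back t)
    loc jl t = atW (j + t)

    loc-valid : ∀ e t → t ≤ len e → Valid (loc e t)
    loc-valid zi zero _ = tt
    loc-valid zi (suc t) _ = i<N
    loc-valid zj zero _ = tt
    loc-valid zj (suc t) _ = j<N
    loc-valid zl t t≤ = spokeLoc-valid t t≤
    loc-valid ij t t≤ = ≤-<-trans (n≤o∸m⇒m+n≤o t (<⇒≤ i<j) t≤) j<N
    loc-valid il t t≤ = back<N t t≤
    loc-valid jl t t≤ = ≤-<-trans (n≤o∸m⇒m+n≤o t (<⇒≤ j<l) t≤) l<N

    atW⁻¹ : Loc → ℕ
    atW⁻¹ (atW p) = p
    atW⁻¹ _ = 0

    loc-inj : ∀ e t t' → t ≤ len e → t' ≤ len e → loc e t ≡ loc e t' → t ≡ t'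
    loc-inj zi zero zero _ _ _ = refl
    loc-inj zi (suc zero) (suc zero) _ _ _ = refl
    loc-inj zi (suc (suc _)) _ (s≤s ()) _ _
    loc-inj zi _ (suc (suc _)) _ (s≤s ()) _
    loc-inj zj zero zero _ _ _ = refl
    loc-inj zj (suc zero) (suc zero) _ _ _ = refl
    loc-inj zj (suc (suc _)) _ (s≤s ()) _ _
    loc-inj zj _ (suc (suc _)) _ (s≤s ()) _
    loc-inj zl t t' t≤ t'≤ eq = sp-inj t t' t≤ t'≤ (trans (sym (⟦spokeLoc⟧ t t≤)) (trans (cong ⟦_⟧ eq) (⟦spokeLoc⟧ t' t'≤)))
    loc-inj ij t t' _ _ eq = +-cancelˡ-≡ i t t' (cong atW⁻¹ eq)
    loc-inj il t t' t≤ t'≤ eq = back-inj t t' t≤ t'≤ (cong atW⁻¹ eq)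
    loc-inj jl t t' _ _ eq = +-cancelˡ-≡ j t t' (cong atW⁻¹ eq)

    arc-step : ∀ {a b} t → a < b → b < N → t < b ∸ a → E (w (a + t)) (w (a + suc t))
    arc-step {a} t a<b b<N t< = w-⇒adj (a + t) (a + suc t) (<-trans a+t<b b<N)
      (subst (_< N) (sym (+-suc a t)) (≤-<-trans a+t<b b<N)) (inj₁ (sym (+-suc a t)))
      where a+t<b = n<o∸m⇒m+n<o t (<⇒≤ a<b) t<

    loc-step : ∀ e t → t < len e → E ⟦ loc e t ⟧ ⟦ loc e (suc t) ⟧
    loc-step zi zero _ = z~wi
    loc-step zj zero _ = z~wj
    loc-step zi (suc t) (s≤s ())
    loc-step zj (suc t) (s≤s ())
    loc-step zl t t< = subst₂ E (sym (⟦spokeLoc⟧ t (<⇒≤ t<))) (sym (⟦spokeLoc⟧ (suc t) t<)) (sp-step t t<)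
    loc-step ij t t< = arc-step t i<j j<N t<
    loc-step il t t< = w-⇒adj (back t) (back (suc t)) (back<N t (<⇒≤ t<)) (back<N (suc t) t<) (back-step t t<)
    loc-step jl t t< = arc-step t j<l l<N t<

    -- Each non-branch vertex lies on exactly one of the six paths, namely its owner.
    owner : Loc → Fin 6
    owner atZ = zi
    owner (atSp _) = zl
    owner (atW p) with p <? j | i <? p | p <? l
    ... | yes _ | yes _ | _     = ij
    ... | yes _ | no _  | _     = il
    ... | no _  | _     | yes _ = jl
    ... | no _  | _     | no _  = il

    owner-ij : ∀ p → i < p → p < j → owner (atW p) ≡ ij
    owner-ij p i<p p<j with p <? j | i <? p
    ... | yes _ | yes _ = refl
    ... | no ¬q | _     = ⊥-elim (¬q p<j)
    ... | yes _ | no ¬q = ⊥-elim (¬q i<p)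

    owner-jl : ∀ p → j < p → p < l → owner (atW p) ≡ jl
    owner-jl p j<p p<l with p <? j | i <? p | p <? l
    ... | yes q | _ | _     = ⊥-elim (<-asym j<p q)
    ... | no _  | _ | yes _ = refl
    ... | no _  | _ | no ¬q = ⊥-elim (¬q p<l)

    owner-il-below : ∀ p → p < i → owner (atW p) ≡ il
    owner-il-below p p<i with p <? j | i <? p
    ... | yes _ | yes q = ⊥-elim (<-asym p<i q)
    ... | yes _ | no _  = refl
    ... | no ¬q | _     = ⊥-elim (¬q (<-trans p<i i<j))

    owner-il-above : ∀ p → l < p → owner (atW p) ≡ il
    owner-il-above p l<p with p <? j | i <? p | p <? l
    ... | yes q | _ | _     = ⊥-elim (<-asym l<p (<-trans q j<l))
    ... | no _  | _ | yes q = ⊥-elim (<-asym l<p q)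
    ... | no _  | _ | no _  = refl

    ¬branch⇒≢ : ∀ {p} → ¬ Branch (atW p) → p ≢ i × p ≢ j × p ≢ l
    ¬branch⇒≢ nb = (λ e → nb (inj₁ e)) , (λ e → nb (inj₂ (inj₁ e))) , (λ e → nb (inj₂ (inj₂ e)))

    ¬branch-below-i : ∀ {p} → p < i → ¬ Branch (atW p)
    ¬branch-below-i p<i (inj₁ refl) = <-irrefl refl p<i
    ¬branch-below-i p<i (inj₂ (inj₁ refl)) = <-irrefl refl (<-trans p<i i<j)
    ¬branch-below-i p<i (inj₂ (inj₂ refl)) = <-irrefl refl (<-trans p<i i<l)

    ¬branch-above-l : ∀ {p} → l < p → ¬ Branch (atW p)
    ¬branch-above-l l<p (inj₁ refl) = <-irrefl refl (<-trans i<l l<p)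
    ¬branch-above-l l<p (inj₂ (inj₁ refl)) = <-irrefl refl (<-trans j<l l<p)
    ¬branch-above-l l<p (inj₂ (inj₂ refl)) = <-irrefl refl l<p

    ¬branch-ij : ∀ {p} → i < p → p < j → ¬ Branch (atW p)
    ¬branch-ij i<p p<j (inj₁ refl) = <-irrefl refl i<p
    ¬branch-ij i<p p<j (inj₂ (inj₁ refl)) = <-irrefl refl p<j
    ¬branch-ij i<p p<j (inj₂ (inj₂ refl)) = <-irrefl refl (<-trans p<j j<l)

    ¬branch-jl : ∀ {p} → j < p → p < l → ¬ Branch (atW p)
    ¬branch-jl j<p p<l (inj₁ refl) = <-irrefl refl (<-trans i<j j<p)
    ¬branch-jl j<p p<l (inj₂ (inj₁ refl)) = <-irrefl refl j<p
    ¬branch-jl j<p p<l (inj₂ (inj₂ refl)) = <-irrefl refl p<l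

    owner-loc : ∀ e t → t ≤ len e → ¬ Branch (loc e t) → owner (loc e t) ≡ e
    owner-loc zi zero _ nb = ⊥-elim (nb tt)
    owner-loc zi (suc _) _ nb = ⊥-elim (nb (inj₁ refl))
    owner-loc zj zero _ nb = ⊥-elim (nb tt)
    owner-loc zj (suc _) _ nb = ⊥-elim (nb (inj₂ (inj₁ refl)))
    owner-loc zl zero _ nb = ⊥-elim (nb tt)
    owner-loc zl (suc t) _ nb with suc t <? ℓ
    ... | yes _ = refl
    ... | no _  = ⊥-elim (nb (inj₂ (inj₂ refl)))
    owner-loc ij t t≤ nb = let (≢i , ≢j , _) = ¬branch⇒≢ nb in
      owner-ij (i + t) (≤∧≢⇒< (m≤m+n i t) (≢-sym ≢i)) (≤∧≢⇒< (n≤o∸m⇒m+n≤o t (<⇒≤ i<j) t≤) ≢j)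
    owner-loc il t t≤ nb = let (≢i , _ , ≢l) = ¬branch⇒≢ nb in owner-back t t≤ ≢i ≢l (t ≤? i)
      where
        owner-back : ∀ t → t ≤ backLen → back t ≢ i → back t ≢ l → Dec (t ≤ i) → owner (atW (back t)) ≡ il
        owner-back t _ ≢i _ (yes p) =
          owner-il-below (back t) (≤∧≢⇒< (subst (_≤ i) (sym (back-≤ t p)) (m∸n≤m i t)) ≢i)
        owner-back t t≤ _ ≢l (no ¬p) = owner-il-above (back t) (≤∧≢⇒< (l≤back t (≰⇒> ¬p) t≤) (≢-sym ≢l))
    owner-loc jl t t≤ nb = let (_ , ≢j , ≢l) = ¬branch⇒≢ nb in
      owner-jl (j + t) (≤∧≢⇒< (m≤m+n j t) (≢-sym ≢j)) (≤∧≢⇒< (n≤o∸m⇒m+n≤o t (<⇒≤ j<l) t≤) ≢l)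

    a<a+t : ∀ a t → 0 < t → a < a + t
    a<a+t a t 0<t = subst (_< a + t) (+-identityʳ a) (+-monoʳ-< a 0<t)

    interior-¬branch : ∀ e t → 0 < t → t < len e → ¬ Branch (loc e t)
    interior-¬branch zi (suc t) _ (s≤s ())
    interior-¬branch zj (suc t) _ (s≤s ())
    interior-¬branch zl t 0<t t< b = subst Branch (spokeLoc-interior t 0<t t<) b
    interior-¬branch ij t 0<t t< = ¬branch-ij (a<a+t i t 0<t) (n<o∸m⇒m+n<o t (<⇒≤ i<j) t<)
    interior-¬branch il t 0<t t< = back-¬branch (t ≤? i)
      where
        back-¬branch : Dec (t ≤ i) → ¬ Branch (atW (back t))
        back-¬branch (yes p) = ¬branch-below-i (subst (_< i) (sym (back-≤ t p)) (0<n≤m⇒m∸n<m 0<t p))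
        back-¬branch (no ¬p) = ¬branch-above-l (l<back t (≰⇒> ¬p) t<)
    interior-¬branch jl t 0<t t< = ¬branch-jl (a<a+t j t 0<t) (n<o∸m⇒m+n<o t (<⇒≤ j<l) t<)

    PathEdge : Loc → Loc → Set
    PathEdge a b = Σ (Fin 6) λ g → Σ ℕ λ t → t < len g ×
                     ((loc g t ≡ a × loc g (suc t) ≡ b) ⊎ (loc g t ≡ b × loc g (suc t) ≡ a))

    PathEdge-sym : ∀ {a b} → PathEdge a b → PathEdge b a
    PathEdge-sym (g , t , t< , inj₁ e) = g , t , t< , inj₂ e
    PathEdge-sym (g , t , t< , inj₂ e) = g , t , t< , inj₁ e

    pathEdge-suc : ∀ p → suc p < N → PathEdge (atW p) (atW (suc p))
    pathEdge-suc p sp<N with p <? i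
    ... | yes p<i = il , i ∸ suc p , <-≤-trans (0<n≤m⇒m∸n<m z<s p<i) (m≤m+n i (N ∸ l)) ,
          inj₂ (cong atW (trans (back-≤ (i ∸ suc p) (m∸n≤m i (suc p))) (m∸[m∸n]≡n p<i)) ,
                cong atW (trans (cong back (1+[m∸[1+n]]≡m∸n i p p<i))
                   (trans (back-≤ (i ∸ p) (m∸n≤m i p)) (m∸[m∸n]≡n (<⇒≤ p<i)))))
    ... | no ¬p<i with p <? j | p <? l
    ...   | yes p<j | _ = ij , p ∸ i , ∸-monoˡ-< p<j (≮⇒≥ ¬p<i) ,
              inj₁ (cong atW (m+[n∸m]≡n (≮⇒≥ ¬p<i)) ,
                    cong atW (trans (+-suc i (p ∸ i)) (cong suc (m+[n∸m]≡n (≮⇒≥ ¬p<i)))))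
    ...   | no ¬p<j | yes p<l = jl , p ∸ j , ∸-monoˡ-< p<l (≮⇒≥ ¬p<j) ,
              inj₁ (cong atW (m+[n∸m]≡n (≮⇒≥ ¬p<j)) ,
                    cong atW (trans (+-suc j (p ∸ j)) (cong suc (m+[n∸m]≡n (≮⇒≥ ¬p<j)))))
    ...   | no _ | no ¬p<l = il , t , t<backLen ,
              inj₂ (cong atW (trans (back-> t i<t) (m∸[m∸n]≡n 1+p≤)) ,
                    cong atW (trans (cong back 1+t≡) (trans (back-> (N + i ∸ p) (subst (i <_) 1+t≡ (<-trans i<t (n<1+n t))))
                      (m∸[m∸n]≡n (<⇒≤ 1+p≤)))))
      where
        t = N + i ∸ suc p
        1+p≤ : suc p ≤ N + i
        1+p≤ = ≤-trans (<⇒≤ sp<N) (m≤m+n N i)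
        i<t : i < t
        i<t = subst (_< t) (m+n∸m≡n N i) (∸-monoʳ-< sp<N (m≤m+n N i))
        1+t≡ : suc t ≡ N + i ∸ p
        1+t≡ = 1+[m∸[1+n]]≡m∸n (N + i) p 1+p≤
        t<backLen : t < backLen
        t<backLen = subst (t <_) (trans (cong (_∸ l) (+-comm N i)) (+-∸-assoc i (<⇒≤ l<N)))
                      (∸-monoʳ-< (s≤s (≮⇒≥ ¬p<l)) 1+p≤)

    pathEdge-wrap : ∀ q → suc q ≡ N → PathEdge (atW q) (atW 0)
    pathEdge-wrap q eq = il , i , i<backLen ,
      inj₂ (cong atW (trans (back-≤ i ≤-refl) (n∸n≡0 i)) ,
            cong atW (trans (back-> (suc i) (n<1+n i)) (trans (cong (λ u → u + i ∸ suc i) (sym eq)) (m+n∸n≡m q i))))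

    pathEdge-cycle : ∀ p q → p < N → q < N → CycAdjℕ N p q → PathEdge (atW p) (atW q)
    pathEdge-cycle p q p< q< (inj₁ refl) = pathEdge-suc p q<
    pathEdge-cycle p q p< q< (inj₂ (inj₁ refl)) = PathEdge-sym (pathEdge-suc q p<)
    pathEdge-cycle p q p< q< (inj₂ (inj₂ (inj₁ (refl , e)))) = PathEdge-sym (pathEdge-wrap q e)
    pathEdge-cycle p q p< q< (inj₂ (inj₂ (inj₂ (refl , e)))) = pathEdge-wrap p e

    adj⇒PathEdge : ∀ a b → Valid a → Valid b → E ⟦ a ⟧ ⟦ b ⟧ → PathEdge a b
    adj⇒PathEdge atZ atZ _ _ e = ⊥-elim (E-irrefl e)
    adj⇒PathEdge atZ (atW p) _ vb e with z~w⇒ p vb e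
    ... | inj₁ refl = zi , 0 , s≤s z≤n , inj₁ (refl , refl)
    ... | inj₂ (inj₁ refl) = zj , 0 , s≤s z≤n , inj₁ (refl , refl)
    ... | inj₂ (inj₂ (ℓ≡1 , refl)) = zl , 0 , ℓ≥1 , inj₁ (refl , spokeLoc-end 1 z<s (<-irrefl (sym ℓ≡1)))
    adj⇒PathEdge atZ (atSp r) _ (0<r , r<ℓ) e with sp-adj⇒ 0 r z≤n (<⇒≤ r<ℓ) (subst (λ u → E u (sp r)) (sym sp0) e)
    ... | inj₁ refl = zl , 0 , ℓ≥1 , inj₁ (refl , spokeLoc-interior 1 z<s r<ℓ)
    ... | inj₂ ()
    adj⇒PathEdge (atW p) atZ va vb e = PathEdge-sym (adj⇒PathEdge atZ (atW p) vb va (E-sym e))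
    adj⇒PathEdge (atW p) (atW q) va vb e = pathEdge-cycle p q va vb (w-adj⇒ p q va vb e)
    adj⇒PathEdge (atW p) (atSp r) va vb e = PathEdge-sym (adj⇒PathEdge (atSp r) (atW p) vb va (E-sym e))
    adj⇒PathEdge (atSp r) atZ va vb e = PathEdge-sym (adj⇒PathEdge atZ (atSp r) vb va (E-sym e))
    adj⇒PathEdge (atSp r) (atW p) (0<r , r<ℓ) vb e with sp~w⇒ r p 0<r r<ℓ vb e
    ... | (1+r≡ℓ , refl) = zl , r , r<ℓ , inj₁ (spokeLoc-interior r 0<r r<ℓ , spokeLoc-end (suc r) z<s (<-irrefl 1+r≡ℓ))
    adj⇒PathEdge (atSp r) (atSp r') (0<r , r<ℓ) (0<r' , r'<ℓ) e with sp-adj⇒ r r' (<⇒≤ r<ℓ) (<⇒≤ r'<ℓ) e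
    ... | inj₁ refl = zl , r , r<ℓ , inj₁ (spokeLoc-interior r 0<r r<ℓ , spokeLoc-interior (suc r) z<s r'<ℓ)
    ... | inj₂ refl = zl , r' , r'<ℓ , inj₂ (spokeLoc-interior r' 0<r' r'<ℓ , spokeLoc-interior (suc r') z<s r<ℓ)

    branchLoc : Fin 4 → Loc
    branchLoc fzero = atZ
    branchLoc (fsuc fzero) = atW i
    branchLoc (fsuc (fsuc fzero)) = atW j
    branchLoc (fsuc (fsuc (fsuc fzero))) = atW l

    branchLoc-valid : ∀ a → Valid (branchLoc a)
    branchLoc-valid fzero = tt
    branchLoc-valid (fsuc fzero) = i<N
    branchLoc-valid (fsuc (fsuc fzero)) = j<N
    branchLoc-valid (fsuc (fsuc (fsuc fzero))) = l<N

    branchLoc-inj : ∀ a b → branchLoc a ≡ branchLoc b → a ≡ b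
    branchLoc-inj fzero fzero _ = refl
    branchLoc-inj (fsuc fzero) (fsuc fzero) _ = refl
    branchLoc-inj (fsuc (fsuc fzero)) (fsuc (fsuc fzero)) _ = refl
    branchLoc-inj (fsuc (fsuc (fsuc fzero))) (fsuc (fsuc (fsuc fzero))) _ = refl
    branchLoc-inj fzero (fsuc fzero) ()
    branchLoc-inj fzero (fsuc (fsuc fzero)) ()
    branchLoc-inj fzero (fsuc (fsuc (fsuc fzero))) ()
    branchLoc-inj (fsuc fzero) fzero ()
    branchLoc-inj (fsuc (fsuc fzero)) fzero ()
    branchLoc-inj (fsuc (fsuc (fsuc fzero))) fzero ()
    branchLoc-inj (fsuc fzero) (fsuc (fsuc fzero)) e = ⊥-elim (<⇒≢ i<j (cong atW⁻¹ e))
    branchLoc-inj (fsuc fzero) (fsuc (fsuc (fsuc fzero))) e = ⊥-elim (<⇒≢ i<l (cong atW⁻¹ e))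
    branchLoc-inj (fsuc (fsuc fzero)) (fsuc (fsuc (fsuc fzero))) e = ⊥-elim (<⇒≢ j<l (cong atW⁻¹ e))
    branchLoc-inj (fsuc (fsuc fzero)) (fsuc fzero) e = ⊥-elim (<⇒≢ i<j (sym (cong atW⁻¹ e)))
    branchLoc-inj (fsuc (fsuc (fsuc fzero))) (fsuc fzero) e = ⊥-elim (<⇒≢ i<l (sym (cong atW⁻¹ e)))
    branchLoc-inj (fsuc (fsuc (fsuc fzero))) (fsuc (fsuc fzero)) e = ⊥-elim (<⇒≢ j<l (sym (cong atW⁻¹ e)))

    loc-start : ∀ e → loc e 0 ≡ branchLoc (k4-end₁ e)
    loc-start zi = refl
    loc-start zj = refl
    loc-start zl = refl
    loc-start ij = cong atW (+-identityʳ i)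
    loc-start il = cong atW (back-≤ 0 z≤n)
    loc-start jl = cong atW (+-identityʳ j)

    loc-end : ∀ e → loc e (len e) ≡ branchLoc (k4-end₂ e)
    loc-end zi = refl
    loc-end zj = refl
    loc-end zl = spokeLoc-end ℓ ℓ≥1 (n≮n ℓ)
    loc-end ij = cong atW (m+[n∸m]≡n (<⇒≤ i<j))
    loc-end il = cong atW (trans (back-> backLen i<backLen) N+i∸backLen≡l)
    loc-end jl = cong atW (m+[n∸m]≡n (<⇒≤ j<l))

    path : Fin 6 → GPath G
    path e = record
      { len    = len e
      ; vtx    = λ s → ⟦ loc e (toℕ s) ⟧
      ; inj    = λ s t eq → toℕ-injective (loc-inj e (toℕ s) (toℕ t) (≤-pred (toℕ<n s)) (≤-pred (toℕ<n t))
                   (⟦⟧-inj _ _ (loc-valid e (toℕ s) (≤-pred (toℕ<n s))) (loc-valid e (toℕ t) (≤-pred (toℕ<n t))) eq))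
      ; consec = λ a → subst (λ u → E ⟦ loc e u ⟧ ⟦ loc e (suc (toℕ a)) ⟧) (sym (toℕ-inject₁ a))
                   (loc-step e (toℕ a) (toℕ<n a))
      }

    interior-private : ∀ e f (s : Fin (suc (len e))) (t : Fin (suc (len f))) →
      0 < toℕ s → toℕ s < len e → ⟦ loc e (toℕ s) ⟧ ≡ ⟦ loc f (toℕ t) ⟧ → e ≡ f
    interior-private e f s t 0<s s< eq = begin
      e                    ≡⟨ sym (owner-loc e (toℕ s) s≤ ¬branch) ⟩
      owner (loc e (toℕ s)) ≡⟨ cong owner same ⟩
      owner (loc f (toℕ t)) ≡⟨ owner-loc f (toℕ t) t≤ (subst (λ u → ¬ Branch u) same ¬branch) ⟩
      f                    ∎
      where
        open ≡-Reasoning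
        s≤ = ≤-pred (toℕ<n s)
        t≤ = ≤-pred (toℕ<n t)
        same = ⟦⟧-inj _ _ (loc-valid e (toℕ s) s≤) (loc-valid f (toℕ t) t≤) eq
        ¬branch = interior-¬branch e (toℕ s) 0<s s<

    induced : ∀ e f (s : Fin (suc (len e))) (t : Fin (suc (len f))) →
      E ⟦ loc e (toℕ s) ⟧ ⟦ loc f (toℕ t) ⟧ →
      Σ (Fin 6) λ g → Σ (Fin (len g)) λ a →
        ((⟦ loc g (toℕ (inject₁ a)) ⟧ ≡ ⟦ loc e (toℕ s) ⟧ × ⟦ loc g (suc (toℕ a)) ⟧ ≡ ⟦ loc f (toℕ t) ⟧) ⊎
         (⟦ loc g (toℕ (inject₁ a)) ⟧ ≡ ⟦ loc f (toℕ t) ⟧ × ⟦ loc g (suc (toℕ a)) ⟧ ≡ ⟦ loc e (toℕ s) ⟧))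
    induced e f s t adj
      with adj⇒PathEdge _ _ (loc-valid e (toℕ s) (≤-pred (toℕ<n s))) (loc-valid f (toℕ t) (≤-pred (toℕ<n t))) adj
    ... | (g , a , a< , edge) = g , fromℕ< a< , ⊎-map (λ (e₁ , e₂) → at e₁ , at-suc e₂) (λ (e₁ , e₂) → at e₁ , at-suc e₂) edge
      where
        at : ∀ {x} → loc g a ≡ x → ⟦ loc g (toℕ (inject₁ (fromℕ< a<))) ⟧ ≡ ⟦ x ⟧
        at eq = cong ⟦_⟧ (trans (cong (loc g) (trans (toℕ-inject₁ (fromℕ< a<)) (toℕ-fromℕ< a<))) eq)
        at-suc : ∀ {x} → loc g (suc a) ≡ x → ⟦ loc g (suc (toℕ (fromℕ< a<))) ⟧ ≡ ⟦ x ⟧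
        at-suc eq = cong ⟦_⟧ (trans (cong (λ u → loc g (suc u)) (toℕ-fromℕ< a<)) eq)

    isk4 : ISK4 G
    isk4 = record
      { br               = λ a → ⟦ branchLoc a ⟧
      ; br-inj           = λ a b eq → branchLoc-inj a b (⟦⟧-inj _ _ (branchLoc-valid a) (branchLoc-valid b) eq)
      ; path             = path
      ; path-start       = λ e → cong ⟦_⟧ (loc-start e)
      ; path-end         = λ e → subst (λ u → ⟦ loc e u ⟧ ≡ ⟦ branchLoc (k4-end₂ e) ⟧) (sym (toℕ-fromℕ (len e)))
                                   (cong ⟦_⟧ (loc-end e))
      ; interior-private = interior-private
      ; induced          = induced
      }

  spokedCycle⇒ISK4 : SpokedCycle → ISK4 G
  spokedCycle⇒ISK4 = SpokedCycleISK4.isk4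

  threeNeighbours⇒ISK4 : ∀ {N w} → IsCycle N w → (z : Fin n) (i j l : ℕ) → i < j → j < l → l < N →
    (∀ s → s < N → z ≢ w s) → (∀ s → s < N → E z (w s) → s ≡ i ⊎ s ≡ j ⊎ s ≡ l) →
    E z (w i) → E z (w j) → E z (w l) → ISK4 G
  threeNeighbours⇒ISK4 {N} {w} cyc z i j l i<j j<l l<N z≢w z~w⇒ z~wi z~wj z~wl = spokedCycle⇒ISK4 record
    { N = N ; w = w ; cycle = cyc ; z = z ; i = i ; j = j ; l = l ; i<j = i<j ; j<l = j<l ; l<N = l<N
    ; ℓ = 1 ; ℓ≥1 = s≤s z≤n ; z≢w = z≢w
    ; z~w⇒ = λ s s< e → ⊎-map₂ (⊎-map₂ (refl ,_)) (z~w⇒ s s< e)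
    ; z~wi = z~wi ; z~wj = z~wj ; sp = sp ; sp0 = refl ; spℓ = refl
    ; spoke = record { inj = sp-inj ; adj⇒ = sp-adj⇒ ; step = sp-step }
    ; sp≢w = λ { (suc r) s _ (s≤s ()) _ }
    ; sp~w⇒ = λ { (suc r) s _ (s≤s ()) _ } }
    where
      sp : ℕ → Fin n
      sp zero = z
      sp (suc _) = w l
      sp-inj : ∀ r r' → r ≤ 1 → r' ≤ 1 → sp r ≡ sp r' → r ≡ r'
      sp-inj zero zero _ _ _ = refl
      sp-inj (suc zero) (suc zero) _ _ _ = refl
      sp-inj zero (suc zero) _ _ e = ⊥-elim (z≢w l l<N e)
      sp-inj (suc zero) zero _ _ e = ⊥-elim (z≢w l l<N (sym e))
      sp-inj (suc (suc _)) _ (s≤s ()) _ _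
      sp-inj _ (suc (suc _)) _ (s≤s ()) _
      sp-adj⇒ : ∀ r r' → r ≤ 1 → r' ≤ 1 → E (sp r) (sp r') → suc r ≡ r' ⊎ suc r' ≡ r
      sp-adj⇒ zero zero _ _ e = ⊥-elim (E-irrefl e)
      sp-adj⇒ zero (suc zero) _ _ _ = inj₁ refl
      sp-adj⇒ (suc zero) zero _ _ _ = inj₂ refl
      sp-adj⇒ (suc zero) (suc zero) _ _ e = ⊥-elim (E-irrefl e)
      sp-adj⇒ (suc (suc _)) _ (s≤s ()) _ _
      sp-adj⇒ _ (suc (suc _)) _ (s≤s ()) _
      sp-step : ∀ r → r < 1 → E (sp r) (sp (suc r))
      sp-step zero _ = z~wl
      sp-step (suc _) (s≤s ())

  -- The theorem's situation if x saw only two vertices c α, c β of the sector S = c 0 … c m,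
  -- with the appendix q running from c m back to c 0.
  record TwoOnSector : Set where
    field
      L        : ℕ
      c        : ℕ → Fin n
      c-cycle  : IsCycle L c
      cL       : c L ≡ c 0
      m K      : ℕ
      q        : ℕ → Fin n
      q-path   : IsChordlessPath q K
      q≢c      : ∀ j s → j ≤ K → s < L → q j ≢ c s
      c~q⇒     : ∀ s j → s < L → j ≤ K → E (c s) (q j) → (s ≡ m × j ≡ 0) ⊎ (s ≡ 0 × j ≡ K)
      cm~q0    : E (c m) (q 0)
      c0~qK    : E (c 0) (q K)
      x        : Fin n
      x≢c      : ∀ s → s < L → x ≢ c s
      x~q-once : ∀ j j' → j ≤ K → j' ≤ K → E x (q j) → E x (q j') → j ≡ j'
      α β γ    : ℕ
      α<β      : α < β
      β≤m      : β ≤ m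
      x~c⇒     : ∀ s → s ≤ m → E x (c s) → s ≡ α ⊎ s ≡ β
      x~cα     : E x (c α)
      x~cβ     : E x (c β)
      ¬ends    : ¬ (α ≡ 0 × β ≡ m)
      m<γ      : m < γ
      γ<L      : γ < L
      x~cγ     : E x (c γ)

  module TwoOnSectorISK4 (T : TwoOnSector) where
    open TwoOnSector T
    open IsCycle c-cycle renaming (inj to c-inj; adj⇒ to c-adj⇒; ⇒adj to c-⇒adj)

    m<L : m < L
    m<L = <-trans m<γ γ<L
    1+m<L : suc m < L
    1+m<L = ≤-<-trans m<γ γ<L
    0<m : 0 < m
    0<m = <-≤-trans (≤-<-trans z≤n α<β) β≤m
    ≤m⇒<L : ∀ {s} → s ≤ m → s < L
    ≤m⇒<L s≤ = ≤-<-trans s≤ m<L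

    x≢q : ∀ j → j ≤ K → x ≢ q j
    x≢q j j≤ refl with c~q⇒ γ j γ<L j≤ (E-sym x~cγ)
    ... | inj₁ (e , _) = <-irrefl (sym e) m<γ
    ... | inj₂ (e , _) = <-irrefl (sym e) (≤-<-trans z≤n m<γ)

    sector-path : IsChordlessPath c m
    sector-path = record
      { inj  = λ s t s≤ t≤ → c-inj s t (≤m⇒<L s≤) (≤m⇒<L t≤)
      ; adj⇒ = λ s t s≤ t≤ e → no-wrap s t s≤ t≤ (c-adj⇒ s t (≤m⇒<L s≤) (≤m⇒<L t≤) e)
      ; step = λ s s< → c-⇒adj s (suc s) (≤m⇒<L (<⇒≤ s<)) (≤m⇒<L s<) (inj₁ refl) }
      where
        no-wrap : ∀ s t → s ≤ m → t ≤ m → CycAdjℕ L s t → suc s ≡ t ⊎ suc t ≡ s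
        no-wrap s t _ _ (inj₁ e) = inj₁ e
        no-wrap s t _ _ (inj₂ (inj₁ e)) = inj₂ e
        no-wrap s t _ t≤ (inj₂ (inj₂ (inj₁ (_ , e)))) = ⊥-elim (<-irrefl e (≤-<-trans (s≤s t≤) 1+m<L))
        no-wrap s t s≤ _ (inj₂ (inj₂ (inj₂ (_ , e)))) = ⊥-elim (<-irrefl e (≤-<-trans (s≤s s≤) 1+m<L))

    module Forward = Concatenation c q m K sector-path q-path (λ s j s≤ j≤ e → q≢c j s j≤ (≤m⇒<L s≤) (sym e))
                       (λ s j s≤ j≤ → c~q⇒ s j (≤m⇒<L s≤) j≤) cm~q0 c0~qK

    x-sees-q⇒ISK4 : ∀ j₀ → j₀ ≤ K → E x (q j₀) → ISK4 G
    x-sees-q⇒ISK4 j₀ j₀≤ x~qj₀ =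
      threeNeighbours⇒ISK4 w-isCycle x α β (suc m + j₀) α<β (≤-<-trans β≤m (m≤m+n (suc m) j₀))
        (+-monoʳ-< (suc m) (s≤s j₀≤)) x≢w x~w⇒
        (subst (E x) (sym (w-left α (≤-trans (<⇒≤ α<β) β≤m))) x~cα)
        (subst (E x) (sym (w-left β β≤m)) x~cβ)
        (subst (E x) (sym (w-right j₀)) x~qj₀)
      where
        open Forward
        x≢w : ∀ s → s < N → x ≢ w s
        x≢w s s< with side s s<
        ... | left p = λ e → x≢c s (≤m⇒<L p) (trans e (w-left s p))
        ... | right j j≤ refl = λ e → x≢q j j≤ (trans e (w-right j))
        x~w⇒ : ∀ s → s < N → E x (w s) → s ≡ α ⊎ s ≡ β ⊎ s ≡ suc m + j₀
        x~w⇒ s s< e with side s s<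
        ... | left p = ⊎-map₂ inj₁ (x~c⇒ s p (subst (E x) (w-left s p) e))
        ... | right j j≤ refl = inj₂ (inj₂ (cong (suc m +_) (x~q-once j j₀ j≤ j₀≤ (subst (E x) (w-right j) e) x~qj₀)))

    γ-only-beyond⇒ISK4 : (∀ t → m < t → t < L → t ≢ γ → ¬ E x (c t)) → ISK4 G
    γ-only-beyond⇒ISK4 only =
      threeNeighbours⇒ISK4 c-cycle x α β γ α<β (≤-<-trans β≤m m<γ) γ<L x≢c x~c⇒αβγ x~cα x~cβ x~cγ
      where
        x~c⇒αβγ : ∀ s → s < L → E x (c s) → s ≡ α ⊎ s ≡ β ⊎ s ≡ γ
        x~c⇒αβγ s s< e with s ≤? m
        ... | yes p = ⊎-map₂ inj₁ (x~c⇒ s p e)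
        ... | no ¬p with s ≟ γ
        ...   | yes eq = inj₂ (inj₂ eq)
        ...   | no ne = ⊥-elim (only s (≰⇒> ¬p) s< ne e)

    m≤d∸r : ∀ {d r} → m ≤ d → r ≤ d ∸ m → m ≤ d ∸ r
    m≤d∸r {d} {r} m≤d r≤ = subst (_≤ d ∸ r) (m∸[m∸n]≡n m≤d) (∸-monoʳ-≤ d r≤)

    m<d∸r : ∀ {d r} → m ≤ d → r < d ∸ m → m < d ∸ r
    m<d∸r {d} {r} m≤d r< = subst (_< d ∸ r) (m∸[m∸n]≡n m≤d) (∸-monoʳ-< r< (m∸n≤m d m))

    -- The spoke is x, c d, c (d-1), …, c m; since d + 1 < L it does not reach round to c 0.
    spoke-to-end⇒ISK4 : β < m → (∀ j → j ≤ K → ¬ E x (q j)) → ∀ d → m < d → suc d < L → E x (c d) →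
                        (∀ t → m < t → t < d → ¬ E x (c t)) → ISK4 G
    spoke-to-end⇒ISK4 β<m x≁q d m<d 1+d<L x~cd x≁between = spokedCycle⇒ISK4 record
      { N = N ; w = w ; cycle = w-isCycle ; z = x
      ; i = α ; j = β ; l = m ; i<j = α<β ; j<l = β<m ; l<N = <-≤-trans (n<1+n m) (m≤m+n (suc m) (suc K))
      ; ℓ = ℓ ; ℓ≥1 = s≤s z≤n ; z≢w = x≢w ; z~w⇒ = x~w⇒
      ; z~wi = subst (E x) (sym (w-left α (≤-trans (<⇒≤ α<β) β≤m))) x~cα
      ; z~wj = subst (E x) (sym (w-left β β≤m)) x~cβ
      ; sp = sp ; sp0 = refl ; spℓ = trans (cong c (m∸[m∸n]≡n m≤d)) (sym (w-left m ≤-refl))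
      ; spoke = record { inj = sp-inj ; adj⇒ = sp-adj⇒ ; step = sp-step } ; sp≢w = sp≢w ; sp~w⇒ = sp~w⇒ }
      where
        open Forward
        m≤d = <⇒≤ m<d
        d<L = <-trans (n<1+n d) 1+d<L
        ℓ = suc (d ∸ m)
        sp : ℕ → Fin n
        sp zero = x
        sp (suc r) = c (d ∸ r)
        d∸r<L : ∀ r → d ∸ r < L
        d∸r<L r = ≤-<-trans (m∸n≤m d r) d<L
        r≤d : ∀ {r} → r ≤ d ∸ m → r ≤ d
        r≤d r≤ = ≤-trans r≤ (m∸n≤m d m)
        x≢w : ∀ s → s < N → x ≢ w s
        x≢w s s< with side s s<
        ... | left p = λ e → x≢c s (≤m⇒<L p) (trans e (w-left s p))
        ... | right j j≤ refl = λ e → x≢q j j≤ (trans e (w-right j))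
        x~w⇒ : ∀ s → s < N → E x (w s) → s ≡ α ⊎ s ≡ β ⊎ (ℓ ≡ 1 × s ≡ m)
        x~w⇒ s s< e with side s s<
        ... | left p = ⊎-map₂ inj₁ (x~c⇒ s p (subst (E x) (w-left s p) e))
        ... | right j j≤ refl = ⊥-elim (x≁q j j≤ (subst (E x) (w-right j) e))
        x~spoke⇒first : ∀ r → r ≤ d ∸ m → E x (c (d ∸ r)) → r ≡ 0
        x~spoke⇒first zero _ _ = refl
        x~spoke⇒first (suc r) r≤ e with m≤n⇒m<n∨m≡n (m≤d∸r m≤d r≤)
        ... | inj₁ m< = ⊥-elim (x≁between (d ∸ suc r) m< (0<n≤m⇒m∸n<m z<s (r≤d r≤)) e)
        ... | inj₂ m≡ with x~c⇒ m ≤-refl (subst (λ u → E x (c u)) (sym m≡) e)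
        ...   | inj₁ m≡α = ⊥-elim (<-irrefl (sym m≡α) (<-trans α<β β<m))
        ...   | inj₂ m≡β = ⊥-elim (<-irrefl (sym m≡β) β<m)
        sp-inj : ∀ r r' → r ≤ ℓ → r' ≤ ℓ → sp r ≡ sp r' → r ≡ r'
        sp-inj zero zero _ _ _ = refl
        sp-inj zero (suc r') _ _ e = ⊥-elim (x≢c (d ∸ r') (d∸r<L r') e)
        sp-inj (suc r) zero _ _ e = ⊥-elim (x≢c (d ∸ r) (d∸r<L r) (sym e))
        sp-inj (suc r) (suc r') (s≤s r≤) (s≤s r'≤) e =
          cong suc (∸-cancelˡ-≡ (r≤d r≤) (r≤d r'≤) (c-inj _ _ (d∸r<L r) (d∸r<L r') e))
        sp-adj⇒ : ∀ r r' → r ≤ ℓ → r' ≤ ℓ → E (sp r) (sp r') → suc r ≡ r' ⊎ suc r' ≡ r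
        sp-adj⇒ zero zero _ _ e = ⊥-elim (E-irrefl e)
        sp-adj⇒ zero (suc r') _ (s≤s r'≤) e = inj₁ (cong suc (sym (x~spoke⇒first r' r'≤ e)))
        sp-adj⇒ (suc r) zero (s≤s r≤) _ e = inj₂ (cong suc (sym (x~spoke⇒first r r≤ (E-sym e))))
        sp-adj⇒ (suc r) (suc r') (s≤s r≤) (s≤s r'≤) e with c-adj⇒ _ _ (d∸r<L r) (d∸r<L r') e
        ... | inj₁ e' = inj₂ (cong suc (1+[m∸n]≡m∸o⇒1+o≡n d r r' (r≤d r≤) (r≤d r'≤) e'))
        ... | inj₂ (inj₁ e') = inj₁ (cong suc (1+[m∸n]≡m∸o⇒1+o≡n d r' r (r≤d r'≤) (r≤d r≤) e'))
        ... | inj₂ (inj₂ (inj₁ (e0 , _))) = ⊥-elim (<-irrefl (sym e0) (<-≤-trans 0<m (m≤d∸r m≤d r≤)))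
        ... | inj₂ (inj₂ (inj₂ (e0 , _))) = ⊥-elim (<-irrefl (sym e0) (<-≤-trans 0<m (m≤d∸r m≤d r'≤)))
        sp-step : ∀ r → r < ℓ → E (sp r) (sp (suc r))
        sp-step zero _ = x~cd
        sp-step (suc r) (s≤s r<) = c-⇒adj _ _ (d∸r<L r) (d∸r<L (suc r))
          (inj₂ (inj₁ (1+[m∸[1+n]]≡m∸n d r (<-≤-trans r< (m∸n≤m d m)))))
        sp≢w : ∀ r s → 0 < r → r < ℓ → s < N → sp r ≢ w s
        sp≢w (suc r) s _ (s≤s r<) s< e with side s s<
        ... | left p = <-irrefl (sym (c-inj _ _ (d∸r<L r) (≤m⇒<L p) (trans e (w-left s p)))) (≤-<-trans p (m<d∸r m≤d r<))
        ... | right j j≤ refl = q≢c j (d ∸ r) j≤ (d∸r<L r) (sym (trans e (w-right j)))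
        sp~w⇒ : ∀ r s → 0 < r → r < ℓ → s < N → E (sp r) (w s) → suc r ≡ ℓ × s ≡ m
        sp~w⇒ (suc r) s _ (s≤s r<) s< e with side s s<
        ... | right j j≤ refl with c~q⇒ (d ∸ r) j (d∸r<L r) j≤ (subst (E (c (d ∸ r))) (w-right j) e)
        ...   | inj₁ (e1 , _) = ⊥-elim (<-irrefl (sym e1) (m<d∸r m≤d r<))
        ...   | inj₂ (e1 , _) = ⊥-elim (<-irrefl (sym e1) (≤-<-trans z≤n (m<d∸r m≤d r<)))
        sp~w⇒ (suc r) s _ (s≤s r<) s< e | left p with c-adj⇒ _ _ (d∸r<L r) (≤m⇒<L p) (subst (E (c (d ∸ r))) (w-left s p) e)
        ...   | inj₁ e1 = ⊥-elim (<-irrefl (sym e1) (s≤s (≤-trans p (<⇒≤ (m<d∸r m≤d r<)))))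
        ...   | inj₂ (inj₁ e1) = let s≡m = ≤-antisym p (≤-pred (subst (m <_) (sym e1) (m<d∸r m≤d r<))) in
                  cong suc (1+[m∸n]≡m∸o⇒1+o≡n d (d ∸ m) r (m∸n≤m d m) (<⇒≤ (<-≤-trans r< (m∸n≤m d m)))
                     (trans (cong suc (m∸[m∸n]≡n m≤d)) (trans (cong suc (sym s≡m)) e1))) , s≡m
        ...   | inj₂ (inj₂ (inj₁ (e1 , _))) = ⊥-elim (<-irrefl (sym e1) (≤-<-trans z≤n (m<d∸r m≤d r<)))
        ...   | inj₂ (inj₂ (inj₂ (_ , e1))) = ⊥-elim (<-irrefl e1 (≤-<-trans (s≤s (m∸n≤m d r)) 1+d<L))

    c-inj-≤L : ∀ s t → 0 < s → 0 < t → s ≤ L → t ≤ L → c s ≡ c t → s ≡ t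
    c-inj-≤L s t 0<s 0<t s≤ t≤ eq with m≤n⇒m<n∨m≡n s≤ | m≤n⇒m<n∨m≡n t≤
    ... | inj₁ s< | inj₁ t< = c-inj s t s< t< eq
    ... | inj₂ refl | inj₂ refl = refl
    ... | inj₂ refl | inj₁ t< = ⊥-elim (<-irrefl (sym (c-inj t 0 t< (≤-<-trans z≤n t<) (trans (sym eq) cL))) 0<t)
    ... | inj₁ s< | inj₂ refl = ⊥-elim (<-irrefl (sym (c-inj s 0 s< (≤-<-trans z≤n s<) (trans eq cL))) 0<s)

    c-adj⇒-≤L : ∀ s t → 2 ≤ s → 2 ≤ t → s ≤ L → t ≤ L → E (c s) (c t) → suc s ≡ t ⊎ suc t ≡ s
    c-adj⇒-≤L s t 2≤s 2≤t s≤ t≤ e with m≤n⇒m<n∨m≡n s≤ | m≤n⇒m<n∨m≡n t≤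
    ... | inj₂ refl | inj₂ refl = ⊥-elim (E-irrefl e)
    ... | inj₁ s< | inj₁ t< with c-adj⇒ s t s< t< e
    ...   | inj₁ e' = inj₁ e'
    ...   | inj₂ (inj₁ e') = inj₂ e'
    ...   | inj₂ (inj₂ (inj₁ (refl , _))) = ⊥-elim (<-irrefl refl (<-≤-trans z<s 2≤s))
    ...   | inj₂ (inj₂ (inj₂ (refl , _))) = ⊥-elim (<-irrefl refl (<-≤-trans z<s 2≤t))
    c-adj⇒-≤L s t 2≤s 2≤t s≤ t≤ e | inj₂ refl | inj₁ t< with c-adj⇒ 0 t (≤-<-trans z≤n t<) t< (subst (λ u → E u (c t)) cL e)
    ...   | inj₁ refl = ⊥-elim (<-irrefl refl 2≤t)
    ...   | inj₂ (inj₁ ())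
    ...   | inj₂ (inj₂ (inj₁ (_ , e'))) = inj₂ e'
    ...   | inj₂ (inj₂ (inj₂ (refl , _))) = ⊥-elim (<-irrefl refl (<-≤-trans z<s 2≤t))
    c-adj⇒-≤L s t 2≤s 2≤t s≤ t≤ e | inj₁ s< | inj₂ refl with c-adj⇒ s 0 s< (≤-<-trans z≤n s<) (subst (E (c s)) cL e)
    ...   | inj₁ ()
    ...   | inj₂ (inj₁ refl) = ⊥-elim (<-irrefl refl 2≤s)
    ...   | inj₂ (inj₂ (inj₁ (refl , _))) = ⊥-elim (<-irrefl refl (<-≤-trans z<s 2≤s))
    ...   | inj₂ (inj₂ (inj₂ (_ , e'))) = inj₁ e'

    c-step-≤L : ∀ s → suc s ≤ L → E (c s) (c (suc s))
    c-step-≤L s s< with m≤n⇒m<n∨m≡n s<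
    ... | inj₁ 1+s<L = c-⇒adj s (suc s) (<-trans (n<1+n s) 1+s<L) 1+s<L (inj₁ refl)
    ... | inj₂ eq = subst (λ u → E (c s) (c u)) (sym eq)
                      (subst (E (c s)) (sym cL) (c-⇒adj s 0 s< (≤-<-trans z≤n s<) (inj₂ (inj₂ (inj₂ (refl , eq))))))

    x≢c-≤L : ∀ t → t ≤ L → x ≢ c t
    x≢c-≤L t t≤ with m≤n⇒m<n∨m≡n t≤
    ... | inj₁ t< = x≢c t t<
    ... | inj₂ refl = λ e → x≢c 0 (≤-<-trans z≤n m<L) (trans e cL)

    swap-ends : ∀ s j → s ≤ m → j ≤ K → (m ∸ s ≡ m × K ∸ j ≡ 0) ⊎ (m ∸ s ≡ 0 × K ∸ j ≡ K) →
                (s ≡ m × j ≡ 0) ⊎ (s ≡ 0 × j ≡ K)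
    swap-ends s j s≤ j≤ (inj₁ (e1 , e2)) = inj₂ (m∸n≡m⇒n≡0 s≤ e1 , m∸n≡0⇒n≡m j≤ e2)
    swap-ends s j s≤ j≤ (inj₂ (e1 , e2)) = inj₁ (m∸n≡0⇒n≡m s≤ e1 , m∸n≡m⇒n≡0 j≤ e2)

    module Reversed = Concatenation (λ t → c (m ∸ t)) (λ j → q (K ∸ j)) m K (reverse sector-path) (reverse q-path)
      (λ s j s≤ j≤ e → q≢c (K ∸ j) (m ∸ s) (m∸n≤m K j) (≤m⇒<L (m∸n≤m m s)) (sym e))
      (λ s j s≤ j≤ e → swap-ends s j s≤ j≤ (c~q⇒ (m ∸ s) (K ∸ j) (≤m⇒<L (m∸n≤m m s)) (m∸n≤m K j) e))
      (subst₂ (λ u v → E (c u) (q v)) (sym (n∸n≡0 m)) refl c0~qK)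
      (subst (λ v → E (c m) (q v)) (sym (n∸n≡0 K)) cm~q0)

    -- The spoke is x, c e, c (e+1), …, c L = c 0; since m + 1 < e it stays away from c m.
    spoke-to-start⇒ISK4 : β ≡ m → (∀ j → j ≤ K → ¬ E x (q j)) → ∀ e → suc (suc m) ≤ e → e < L → E x (c e) →
                          (∀ t → e < t → t < L → ¬ E x (c t)) → ISK4 G
    spoke-to-start⇒ISK4 β≡m x≁q e 2+m≤e e<L x~ce x≁after = spokedCycle⇒ISK4 record
      { N = N ; w = w ; cycle = w-isCycle ; z = x
      ; i = 0 ; j = m ∸ α ; l = m ; i<j = m<n⇒0<n∸m α<m ; j<l = 0<n≤m⇒m∸n<m 0<α (<⇒≤ α<m)
      ; l<N = <-≤-trans (n<1+n m) (m≤m+n (suc m) (suc K))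
      ; ℓ = ℓ ; ℓ≥1 = s≤s z≤n ; z≢w = x≢w ; z~w⇒ = x~w⇒
      ; z~wi = subst (E x) (sym (w-left 0 z≤n)) (subst (λ u → E x (c u)) β≡m x~cβ)
      ; z~wj = subst (E x) (sym (trans (w-left (m ∸ α) (m∸n≤m m α)) (cong c (m∸[m∸n]≡n (<⇒≤ α<m))))) x~cα
      ; sp = sp ; sp0 = refl
      ; spℓ = trans (cong c (m+[n∸m]≡n (<⇒≤ e<L))) (trans cL (sym (trans (w-left m ≤-refl) (cong c (n∸n≡0 m)))))
      ; spoke = record { inj = sp-inj ; adj⇒ = sp-adj⇒ ; step = sp-step } ; sp≢w = sp≢w ; sp~w⇒ = sp~w⇒ }
      where
        open Reversed
        ℓ = suc (L ∸ e)
        0<α : 0 < α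
        0<α with α ≟ 0
        ... | yes α≡0 = ⊥-elim (¬ends (α≡0 , β≡m))
        ... | no α≢0 = ≤∧≢⇒< z≤n (≢-sym α≢0)
        α<m : α < m
        α<m = subst (α <_) β≡m α<β
        2≤e+r : ∀ r → 2 ≤ e + r
        2≤e+r r = ≤-trans (≤-trans (s≤s (s≤s z≤n)) 2+m≤e) (m≤m+n e r)
        0<e+r : ∀ r → 0 < e + r
        0<e+r r = <-≤-trans z<s (2≤e+r r)
        m<e+r : ∀ r → m < e + r
        m<e+r r = <-≤-trans (≤-trans (n≤1+n (suc m)) 2+m≤e) (m≤m+n e r)
        e+r≤L : ∀ {r} → r ≤ L ∸ e → e + r ≤ L
        e+r≤L {r} r≤ = n≤o∸m⇒m+n≤o r (<⇒≤ e<L) r≤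
        e+r<L : ∀ {r} → r < L ∸ e → e + r < L
        e+r<L {r} r< = n<o∸m⇒m+n<o r (<⇒≤ e<L) r<
        sp : ℕ → Fin n
        sp zero = x
        sp (suc r) = c (e + r)
        x≢w : ∀ s → s < N → x ≢ w s
        x≢w s s< with side s s<
        ... | left p = λ eq → x≢c (m ∸ s) (≤m⇒<L (m∸n≤m m s)) (trans eq (w-left s p))
        ... | right j j≤ refl = λ eq → x≢q (K ∸ j) (m∸n≤m K j) (trans eq (w-right j))
        x~w⇒ : ∀ s → s < N → E x (w s) → s ≡ 0 ⊎ s ≡ m ∸ α ⊎ (ℓ ≡ 1 × s ≡ m)
        x~w⇒ s s< ex with side s s<
        ... | right j j≤ refl = ⊥-elim (x≁q (K ∸ j) (m∸n≤m K j) (subst (E x) (w-right j) ex))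
        ... | left p with x~c⇒ (m ∸ s) (m∸n≤m m s) (subst (E x) (w-left s p) ex)
        ...   | inj₁ e1 = inj₂ (inj₁ (trans (sym (m∸[m∸n]≡n p)) (cong (m ∸_) e1)))
        ...   | inj₂ e1 = inj₁ (m∸n≡m⇒n≡0 p (trans e1 β≡m))
        x~spoke⇒first : ∀ r → r ≤ L ∸ e → E x (c (e + r)) → r ≡ 0
        x~spoke⇒first zero _ _ = refl
        x~spoke⇒first (suc r) r≤ ex with m≤n⇒m<n∨m≡n (e+r≤L r≤)
        ... | inj₁ lt = ⊥-elim (x≁after (e + suc r) (a<a+1+r e r) lt ex)
          where a<a+1+r : ∀ a r → a < a + suc r
                a<a+1+r a r = subst (_< a + suc r) (+-identityʳ a) (+-monoʳ-< a z<s)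
        ... | inj₂ e+r≡L with x~c⇒ 0 z≤n (subst (E x) (trans (cong c e+r≡L) cL) ex)
        ...   | inj₁ 0≡α = ⊥-elim (<-irrefl 0≡α 0<α)
        ...   | inj₂ 0≡β = ⊥-elim (<-irrefl (trans 0≡β β≡m) 0<m)
        sp-inj : ∀ r r' → r ≤ ℓ → r' ≤ ℓ → sp r ≡ sp r' → r ≡ r'
        sp-inj zero zero _ _ _ = refl
        sp-inj zero (suc r') _ (s≤s r'≤) eq = ⊥-elim (x≢c-≤L (e + r') (e+r≤L r'≤) eq)
        sp-inj (suc r) zero (s≤s r≤) _ eq = ⊥-elim (x≢c-≤L (e + r) (e+r≤L r≤) (sym eq))
        sp-inj (suc r) (suc r') (s≤s r≤) (s≤s r'≤) eq =
          cong suc (+-cancelˡ-≡ e r r' (c-inj-≤L _ _ (0<e+r r) (0<e+r r') (e+r≤L r≤) (e+r≤L r'≤) eq))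
        sp-adj⇒ : ∀ r r' → r ≤ ℓ → r' ≤ ℓ → E (sp r) (sp r') → suc r ≡ r' ⊎ suc r' ≡ r
        sp-adj⇒ zero zero _ _ ex = ⊥-elim (E-irrefl ex)
        sp-adj⇒ zero (suc r') _ (s≤s r'≤) ex = inj₁ (cong suc (sym (x~spoke⇒first r' r'≤ ex)))
        sp-adj⇒ (suc r) zero (s≤s r≤) _ ex = inj₂ (cong suc (sym (x~spoke⇒first r r≤ (E-sym ex))))
        sp-adj⇒ (suc r) (suc r') (s≤s r≤) (s≤s r'≤) ex
          with c-adj⇒-≤L _ _ (2≤e+r r) (2≤e+r r') (e+r≤L r≤) (e+r≤L r'≤) ex
        ... | inj₁ e' = inj₁ (cong suc (+-cancelˡ-≡ e (suc r) r' (trans (+-suc e r) e')))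
        ... | inj₂ e' = inj₂ (cong suc (+-cancelˡ-≡ e (suc r') r (trans (+-suc e r') e')))
        sp-step : ∀ r → r < ℓ → E (sp r) (sp (suc r))
        sp-step zero _ = subst (λ u → E x (c u)) (sym (+-identityʳ e)) x~ce
        sp-step (suc r) (s≤s r<) = subst (λ u → E (c (e + r)) (c u)) (sym (+-suc e r)) (c-step-≤L (e + r) (e+r<L r<))
        sp≢w : ∀ r s → 0 < r → r < ℓ → s < N → sp r ≢ w s
        sp≢w (suc r) s _ (s≤s r<) s< eq with side s s<
        ... | left p = <-irrefl (sym (c-inj _ _ (e+r<L r<) (≤m⇒<L (m∸n≤m m s)) (trans eq (w-left s p))))
                         (≤-<-trans (m∸n≤m m s) (m<e+r r))
        ... | right j j≤ refl = q≢c (K ∸ j) (e + r) (m∸n≤m K j) (e+r<L r<) (sym (trans eq (w-right j)))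
        sp~w⇒ : ∀ r s → 0 < r → r < ℓ → s < N → E (sp r) (w s) → suc r ≡ ℓ × s ≡ m
        sp~w⇒ (suc r) s _ (s≤s r<) s< ex with side s s<
        ... | right j j≤ refl with c~q⇒ (e + r) (K ∸ j) (e+r<L r<) (m∸n≤m K j) (subst (E (c (e + r))) (w-right j) ex)
        ...   | inj₁ (e1 , _) = ⊥-elim (<-irrefl (sym e1) (m<e+r r))
        ...   | inj₂ (e1 , _) = ⊥-elim (<-irrefl (sym e1) (0<e+r r))
        sp~w⇒ (suc r) s _ (s≤s r<) s< ex | left p
          with c-adj⇒ _ _ (e+r<L r<) (≤m⇒<L (m∸n≤m m s)) (subst (E (c (e + r))) (w-left s p) ex)
        ...   | inj₁ e1 = ⊥-elim (<-irrefl (sym e1) (s≤s (≤-trans (m∸n≤m m s) (<⇒≤ (m<e+r r)))))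
        ...   | inj₂ (inj₁ e1) = ⊥-elim (<-irrefl e1 (≤-<-trans (s≤s (m∸n≤m m s))
                                  (<-≤-trans (n<1+n (suc m)) (≤-trans 2+m≤e (m≤m+n e r)))))
        ...   | inj₂ (inj₂ (inj₁ (e1 , _))) = ⊥-elim (<-irrefl (sym e1) (0<e+r r))
        ...   | inj₂ (inj₂ (inj₂ (e1 , e2))) =
                  cong suc (sym (trans (cong (_∸ e) (sym (trans (+-suc e r) e2))) (m+n∸m≡n e (suc r)))) ,
                  m∸n≡0⇒n≡m p e1

    Beyond : ℕ → Set
    Beyond t = m < t × t < L × E x (c t)

    Beyond? : ∀ t → Dec (Beyond t)
    Beyond? t = (m <? t) ×-dec ((t <? L) ×-dec E-dec x (c t))

    open BoundedSearch Beyond Beyond? renaming (least to leastBeyond; greatest to greatestBeyond)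

    first-of-two-beyond : ∀ γ' → Beyond γ' → γ' ≢ γ →
      Σ ℕ λ d → Beyond d × suc d < L × (∀ t → m < t → t < d → ¬ E x (c t))
    first-of-two-beyond γ' b' γ'≢γ with leastBeyond L
    ... | inj₂ none = ⊥-elim (none γ γ<L (m<γ , γ<L , x~cγ))
    ... | inj₁ (d , d<L , bd , below) = d , bd , 1+d<L ,
          λ t m<t t<d ex → below t t<d (m<t , <-trans t<d d<L , ex)
      where
        after-d : ∀ g → Beyond g → g ≢ d → suc d < L
        after-d g bg g≢d with <-cmp g d
        ... | tri< g<d _ _ = ⊥-elim (below g g<d bg)
        ... | tri≈ _ g≡d _ = ⊥-elim (g≢d g≡d)
        ... | tri> _ _ d<g = ≤-<-trans d<g (proj₁ (proj₂ bg))
        1+d<L : suc d < L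
        1+d<L with γ ≟ d
        ... | yes γ≡d = after-d γ' b' (λ eq → γ'≢γ (trans eq (sym γ≡d)))
        ... | no γ≢d = after-d γ (m<γ , γ<L , x~cγ) γ≢d

    last-of-two-beyond : ∀ γ' → Beyond γ' → γ' ≢ γ →
      Σ ℕ λ e → Beyond e × suc (suc m) ≤ e × (∀ t → e < t → t < L → ¬ E x (c t))
    last-of-two-beyond γ' b' γ'≢γ with greatestBeyond L
    ... | inj₂ none = ⊥-elim (none γ γ<L (m<γ , γ<L , x~cγ))
    ... | inj₁ (e , e<L , be , above) = e , be , 2+m≤e ,
          λ t e<t t<L ex → above t e<t t<L (<-trans (proj₁ be) e<t , t<L , ex)
      where
        before-e : ∀ g → Beyond g → g ≢ e → suc (suc m) ≤ e
        before-e g bg g≢e with <-cmp g e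
        ... | tri< g<e _ _ = ≤-trans (s≤s (proj₁ bg)) g<e
        ... | tri≈ _ g≡e _ = ⊥-elim (g≢e g≡e)
        ... | tri> _ _ e<g = ⊥-elim (above g e<g (proj₁ (proj₂ bg)) bg)
        2+m≤e : suc (suc m) ≤ e
        2+m≤e with γ ≟ e
        ... | yes γ≡e = before-e γ' b' (λ eq → γ'≢γ (trans eq (sym γ≡e)))
        ... | no γ≢e = before-e γ (m<γ , γ<L , x~cγ) γ≢e

    two-beyond⇒ISK4 : (∀ j → j ≤ K → ¬ E x (q j)) → ∀ γ' → Beyond γ' → γ' ≢ γ → ISK4 G
    two-beyond⇒ISK4 x≁q γ' b' γ'≢γ with β <? m
    ... | yes β<m = let (d , (m<d , _ , x~cd) , 1+d<L , first) = first-of-two-beyond γ' b' γ'≢γ in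
                    spoke-to-end⇒ISK4 β<m x≁q d m<d 1+d<L x~cd first
    ... | no β≮m = let (e , (_ , e<L , x~ce) , 2+m≤e , last) = last-of-two-beyond γ' b' γ'≢γ in
                   spoke-to-start⇒ISK4 (≤-antisym β≤m (≮⇒≥ β≮m)) x≁q e 2+m≤e e<L x~ce last

    isk4 : ISK4 G
    isk4 with BoundedSearch.least (λ j → j ≤ K × E x (q j)) (λ j → (j ≤? K) ×-dec (E-dec x (q j))) (suc K)
    ... | inj₁ (j₀ , _ , (j₀≤ , x~qj₀) , _) = x-sees-q⇒ISK4 j₀ j₀≤ x~qj₀
    ... | inj₂ x≁Q with BoundedSearch.least (λ t → Beyond t × t ≢ γ) (λ t → Beyond? t ×-dec ¬? (t ≟ γ)) L
    ...   | inj₁ (γ' , _ , (b' , γ'≢γ) , _) = two-beyond⇒ISK4 (λ j j≤ ex → x≁Q j (s≤s j≤) (j≤ , ex)) γ' b' γ'≢γ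
    ...   | inj₂ only-γ = γ-only-beyond⇒ISK4 (λ t m<t t<L t≢γ ex → only-γ t t<L ((m<t , t<L , ex) , t≢γ))

  twoOnSector⇒ISK4 : TwoOnSector → ISK4 G
  twoOnSector⇒ISK4 = TwoOnSectorISK4.isk4

  module HoleFrom (H : Hole G) (σ : Fin (4 + Hole.k H)) where
    open Hole H
    open Modulo (3 + k)

    idx : ℕ → Fin L
    idx u = (toℕ σ + u) mod L

    c : ℕ → Fin n
    c u = h (idx u)

    toℕ-idx : ∀ u → toℕ (idx u) ≡ (toℕ σ + u) % L
    toℕ-idx u = toℕ-fromℕ< _

    mod-cong : ∀ u v → u % L ≡ v % L → u mod L ≡ v mod L
    mod-cong u v e = toℕ-injective (trans (toℕ-fromℕ< _) (trans e (sym (toℕ-fromℕ< _))))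

    c-periodic : ∀ u → c (u + L) ≡ c u
    c-periodic u = cong h (mod-cong (toℕ σ + (u + L)) (toℕ σ + u) ([a+[u+L]]%L≡[a+u]%L (toℕ σ) u))

    cL : c L ≡ c 0
    cL = c-periodic 0

    private
      c-inj : ∀ s t → s < L → t < L → c s ≡ c t → s ≡ t
      c-inj s t s< t< e = +-%-cancelˡ (toℕ σ) s t (toℕ<n σ) s< t<
        (trans (sym (toℕ-idx s)) (trans (cong toℕ (h-inj _ _ e)) (toℕ-idx t)))

      1+idx : ∀ s → suc (toℕ (idx s)) % L ≡ (toℕ σ + suc s) % L
      1+idx s = trans (cong (λ v → suc v % L) (toℕ-idx s))
                  (trans (1+[m%L]%L≡[1+m]%L (toℕ σ + s)) (cong (_% L) (sym (+-suc (toℕ σ) s))))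

      wrap : ∀ s → suc s ≡ L → (toℕ σ + suc s) % L ≡ (toℕ σ + 0) % L
      wrap s e = trans (cong (λ v → (toℕ σ + v) % L) e) ([a+[u+L]]%L≡[a+u]%L (toℕ σ) 0)

      succ⇒CycAdj : ∀ s t → s < L → t < L → (toℕ σ + suc s) % L ≡ (toℕ σ + t) % L →
                    suc s ≡ t ⊎ (t ≡ 0 × suc s ≡ L)
      succ⇒CycAdj s t s< t< e with m≤n⇒m<n∨m≡n s<
      ... | inj₁ 1+s<L = inj₁ (+-%-cancelˡ (toℕ σ) (suc s) t (toℕ<n σ) 1+s<L t< e)
      ... | inj₂ 1+s≡L = inj₂ (sym (+-%-cancelˡ (toℕ σ) 0 t (toℕ<n σ) z<s t< (trans (sym (wrap s 1+s≡L)) e)) , 1+s≡L)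

      h-succ⇒ : ∀ s t → suc (toℕ (idx s)) mod L ≡ idx t → (toℕ σ + suc s) % L ≡ (toℕ σ + t) % L
      h-succ⇒ s t x = trans (sym (1+idx s)) (trans (sym (toℕ-fromℕ< _)) (trans (cong toℕ x) (toℕ-idx t)))

      ⇒h-succ : ∀ s t → (toℕ σ + suc s) % L ≡ (toℕ σ + t) % L → suc (toℕ (idx s)) mod L ≡ idx t
      ⇒h-succ s t e = toℕ-injective (trans (toℕ-fromℕ< _) (trans (1+idx s) (trans e (sym (toℕ-idx t)))))

      c-adj⇒ : ∀ s t → s < L → t < L → E (c s) (c t) → CycAdjℕ L s t
      c-adj⇒ s t s< t< e with Equivalence.to (h-adj (idx s) (idx t)) e
      ... | inj₁ x = [ inj₁ , (λ y → inj₂ (inj₂ (inj₂ y))) ]′ (succ⇒CycAdj s t s< t< (h-succ⇒ s t x))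
      ... | inj₂ x = [ (λ y → inj₂ (inj₁ y)) , (λ y → inj₂ (inj₂ (inj₁ y))) ]′ (succ⇒CycAdj t s t< s< (h-succ⇒ t s x))

      c-⇒adj : ∀ s t → s < L → t < L → CycAdjℕ L s t → E (c s) (c t)
      c-⇒adj s t _ _ (inj₁ refl) = Equivalence.from (h-adj (idx s) (idx t)) (inj₁ (⇒h-succ s t refl))
      c-⇒adj s t _ _ (inj₂ (inj₁ refl)) = Equivalence.from (h-adj (idx s) (idx t)) (inj₂ (⇒h-succ t s refl))
      c-⇒adj s t _ _ (inj₂ (inj₂ (inj₁ (refl , e)))) =
        Equivalence.from (h-adj (idx 0) (idx t)) (inj₂ (⇒h-succ t 0 (wrap t e)))
      c-⇒adj s t _ _ (inj₂ (inj₂ (inj₂ (refl , e)))) =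
        Equivalence.from (h-adj (idx s) (idx 0)) (inj₁ (⇒h-succ s 0 (wrap s e)))

    c-isCycle : IsCycle L c
    c-isCycle = record { inj = c-inj ; adj⇒ = c-adj⇒ ; ⇒adj = c-⇒adj }

    pos≡c : ∀ a → Σ ℕ λ τ → τ < L × (∀ t → pos G H a t ≡ c (τ + t))
    pos≡c a with rebase-offset (toℕ a) (toℕ σ) (toℕ<n a) (toℕ<n σ)
    ... | τ , τ< , eq = τ , τ< , λ t → cong h (mod-cong (toℕ a + t) (toℕ σ + (τ + t)) (eq t))

  module AppendixPath {H : Hole G} (P : Appendix G H) where
    open Hole H
    open Appendix P

    q : ℕ → Fin n
    q j = p (clamp k' j)

    q-path : IsChordlessPath q k'
    q-path = record
      { inj  = λ s t s≤ t≤ e → clamp-inj k' s t s≤ t≤ (p-inj _ _ e)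
      ; adj⇒ = λ s t s≤ t≤ e → ⊎-map
          (λ z → trans (cong suc (sym (toℕ-clamp k' s s≤))) (trans z (toℕ-clamp k' t t≤)))
          (λ z → trans (cong suc (sym (toℕ-clamp k' t t≤))) (trans z (toℕ-clamp k' s s≤)))
          (Equivalence.to (p-chordless (clamp k' s) (clamp k' t)) e)
      ; step = λ s s< → Equivalence.from (p-chordless (clamp k' s) (clamp k' (suc s)))
          (inj₁ (trans (cong suc (toℕ-clamp k' s (<⇒≤ s<))) (sym (toℕ-clamp k' (suc s) s<))))
      }

    q~h⇒ends : ∀ j a → j ≤ k' → E (q j) (h a) → (j ≡ 0 × a ≡ i₁) ⊎ (j ≡ k' × a ≡ i₂)
    q~h⇒ends zero a _ e with attach
    ... | inj₁ (k'≡0 , iff , _) = ⊎-map (refl ,_) (sym k'≡0 ,_) (Equivalence.to (iff a) e)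
    ... | inj₂ (_ , iff₀ , _) = inj₁ (refl , Equivalence.to (iff₀ a) e)
    q~h⇒ends (suc j) a j≤ e with suc j <? k'
    ... | yes 1+j<k' = ⊥-elim (p-interior (clamp k' (suc j)) (subst (0 <_) (sym (toℕ-clamp k' (suc j) j≤)) z<s)
                         (subst (_< k') (sym (toℕ-clamp k' (suc j) j≤)) 1+j<k') a e)
    ... | no ¬1+j<k' with attach
    ...   | inj₁ (k'≡0 , _) = ⊥-elim (<-irrefl (sym k'≡0) (<-≤-trans z<s j≤))
    ...   | inj₂ (_ , _ , iffₖ) = inj₂ (1+j≡k' , Equivalence.to (iffₖ a)
              (subst (λ u → E (p u) (h a)) (trans (cong (clamp k') 1+j≡k') (clamp-top k')) e))
      where 1+j≡k' = ≤-antisym j≤ (≮⇒≥ ¬1+j<k')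

    q0~hi₁ : E (q 0) (h i₁)
    q0~hi₁ with attach
    ... | inj₁ (_ , iff , _) = Equivalence.from (iff i₁) (inj₁ refl)
    ... | inj₂ (_ , iff₀ , _) = Equivalence.from (iff₀ i₁) refl

    qk'~hi₂ : E (q k') (h i₂)
    qk'~hi₂ with attach
    ... | inj₁ (k'≡0 , iff , _) = subst (λ u → E (p u) (h i₂))
            (toℕ-injective (trans (sym k'≡0) (sym (toℕ-clamp k' k' ≤-refl)))) (Equivalence.from (iff i₂) (inj₂ refl))
    ... | inj₂ (_ , _ , iffₖ) = subst (λ u → E (p u) (h i₂)) (sym (clamp-top k')) (Equivalence.from (iffₖ i₂) refl)

  module SectorOfAppendix (W : Wheel G) (P : Appendix G (Wheel.hole W)) (wa : IsWheelAppendix G W P)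
                          (S : SubPath G (Wheel.hole W)) (sw : SectorWrt G (Wheel.hole W) P S) where
    open Wheel W
    open Hole hole
    open SubPath S
    open Appendix P
    open HoleFrom hole start
    open Modulo (3 + k) using (L; +-%-cancelˡ; [m%L+n]%L≡[m+n]%L)
    open IsCycle c-isCycle renaming (inj to c-inj)

    Nb : ℕ → Set
    Nb u = E x (c u)

    Nb? : ∀ u → Dec (Nb u)
    Nb? u = E-dec x (c u)

    ≤m⇒<L : ∀ {s} → s ≤ m → s < L
    ≤m⇒<L s≤ = ≤-<-trans s≤ m<len

    h≡c : ∀ a → Σ ℕ λ t → t < L × h a ≡ c t
    h≡c a with pos≡c a
    ... | τ , τ< , eq = τ , τ< , trans (cong h (toℕ-injective (sym (trans (toℕ-fromℕ< _)
          (trans (cong (_% L) (+-identityʳ (toℕ a))) (m<n⇒m%n≡m (toℕ<n a))))))) (trans (eq 0) (cong c (+-identityʳ τ)))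

    c-injective-on-S : ∀ {u v} → u < v → v ≤ m → c u ≢ c v
    c-injective-on-S {u} {v} u<v v≤m e = <-irrefl (c-inj u v (≤m⇒<L (≤-trans (<⇒≤ u<v) v≤m)) (≤m⇒<L v≤m) e) u<v

    Consecutive : ℕ → ℕ → Set
    Consecutive u v = u < v × v ≤ m × Nb u × Nb v × (∀ t → u < t → t < v → ¬ Nb t)

    sector-between : ∀ {u v} → Consecutive u v →
      Σ (SubPath G hole) λ T → IsSector G W T × _⊆ₛ_ G hole T S × SubPath.start T ≡ idx u
    sector-between {u} {v} (u<v , v≤m , x~cu , x~cv , between) = T , (x~first , x~last , interior) , T⊆S , refl
      where
        T : SubPath G hole
        T = record { start = idx u ; m = v ∸ u ; m≥1 = m<n⇒0<n∸m u<v
                   ; m<len = ≤-<-trans (≤-trans (m∸n≤m v u) v≤m) m<len }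
        spV≡c : ∀ t → spV G hole T t ≡ c (u + t)
        spV≡c t = cong h (mod-cong (toℕ (idx u) + t) (toℕ start + (u + t))
                    (trans (cong (λ w → (w + t) % L) (toℕ-idx u))
                      (trans ([m%L+n]%L≡[m+n]%L (toℕ start + u) t) (cong (_% L) (+-assoc (toℕ start) u t)))))
        x~first : E x (spV G hole T 0)
        x~first = subst (E x) (sym (trans (spV≡c 0) (cong c (+-identityʳ u)))) x~cu
        x~last : E x (spV G hole T (v ∸ u))
        x~last = subst (E x) (sym (trans (spV≡c (v ∸ u)) (cong c (m+[n∸m]≡n (<⇒≤ u<v))))) x~cv
        interior : ∀ t → 0 < t → t < v ∸ u → ¬ E x (spV G hole T t)
        interior t 0<t t< ex = between (u + t) (subst (_< u + t) (+-identityʳ u) (+-monoʳ-< u 0<t))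
                                 (n<o∸m⇒m+n<o t (<⇒≤ u<v) t<) (subst (E x) (spV≡c t) ex)
        T⊆S : _⊆ₛ_ G hole T S
        T⊆S w (t , t≤ , e) = u + t , ≤-trans (n≤o∸m⇒m+n≤o t (<⇒≤ u<v) t≤) v≤m , trans (sym (spV≡c t)) e

    private
      inner = proj₁ wa S sw

    T : SubPath G hole
    T = proj₁ inner

    T-sector : IsSector G W T
    T-sector = proj₁ (proj₂ inner)

    T⊆S : _⊆ₛ_ G hole T S
    T⊆S = proj₁ (proj₂ (proj₂ inner))

    S⊄T : ∃[ v ] (InSub G hole S v × ¬ InSub G hole T v)
    S⊄T = proj₂ (proj₂ (proj₂ inner))

    t₀ t₁ : ℕ
    t₀ = proj₁ (T⊆S _ (0 , z≤n , refl))
    t₁ = proj₁ (T⊆S _ (SubPath.m T , ≤-refl , refl))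

    t₀≤m : t₀ ≤ m
    t₀≤m = proj₁ (proj₂ (T⊆S _ (0 , z≤n , refl)))
    t₁≤m : t₁ ≤ m
    t₁≤m = proj₁ (proj₂ (T⊆S _ (SubPath.m T , ≤-refl , refl)))

    ct₀≡first : c t₀ ≡ first G hole T
    ct₀≡first = proj₂ (proj₂ (T⊆S _ (0 , z≤n , refl)))
    ct₁≡last : c t₁ ≡ last G hole T
    ct₁≡last = proj₂ (proj₂ (T⊆S _ (SubPath.m T , ≤-refl , refl)))

    x~ct₀ : Nb t₀
    x~ct₀ = subst (E x) (sym ct₀≡first) (proj₁ T-sector)
    x~ct₁ : Nb t₁
    x~ct₁ = subst (E x) (sym ct₁≡last) (proj₁ (proj₂ T-sector))

    t₀≢t₁ : t₀ ≢ t₁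
    t₀≢t₁ eq = <-irrefl (+-%-cancelˡ (toℕ a) 0 (SubPath.m T) (toℕ<n a) z<s (SubPath.m<len T)
                 (trans (sym (toℕ-fromℕ< _)) (trans (cong toℕ (h-inj _ _ first≡last)) (toℕ-fromℕ< _))))
                 (SubPath.m≥1 T)
      where
        a = SubPath.start T
        first≡last = trans (sym ct₀≡first) (trans (cong c eq) ct₁≡last)

    c≡c0⇒≡L : ∀ u → 0 < u → u < L + L → c u ≡ c 0 → u ≡ L
    c≡c0⇒≡L u 0<u u<2L eq with u <? L
    ... | yes u<L = ⊥-elim (<⇒≢ 0<u (sym (c-inj u 0 u<L z<s eq)))
    ... | no u≮L = ≤-antisym (m∸n≡0⇒m≤n (c-inj (u ∸ L) 0 u∸L<L z<s c[u∸L]≡c0)) L≤u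
      where
        L≤u = ≮⇒≥ u≮L
        u∸L<L : u ∸ L < L
        u∸L<L = subst (u ∸ L <_) (m+n∸n≡m L L) (∸-monoˡ-< u<2L L≤u)
        c[u∸L]≡c0 : c (u ∸ L) ≡ c 0
        c[u∸L]≡c0 = trans (sym (c-periodic (u ∸ L))) (trans (cong c (m∸n+n≡m L≤u)) eq)

    module ExactlyTwo (α β : ℕ) (α<β : α < β) (β≤m : β ≤ m) (x~cα : Nb α) (x~cβ : Nb β)
                      (only : ∀ s → s ≤ m → Nb s → s ≡ α ⊎ s ≡ β) where

      beyond-S : Σ ℕ λ γ → m < γ × γ < L × Nb γ
      beyond-S with BoundedSearch.least (λ t → m < t × t < L × Nb t) (λ t → (m <? t) ×-dec ((t <? L) ×-dec Nb? t)) L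
      ... | inj₁ (γ , _ , b , _) = γ , b
      ... | inj₂ none with three-nbrs
      ...   | (a₁ , a₂ , a₃ , a₁≢a₂ , a₁≢a₃ , a₂≢a₃ , x~a₁ , x~a₂ , x~a₃) =
              ⊥-elim (pigeonhole₂ (on-S a₁ x~a₁) (on-S a₂ x~a₂) (on-S a₃ x~a₃) (apart a₁≢a₂) (apart a₁≢a₃) (apart a₂≢a₃))
        where
          position : Fin (4 + k) → ℕ
          position a = proj₁ (h≡c a)
          on-S : ∀ a → E x (h a) → position a ≡ α ⊎ position a ≡ β
          on-S a x~ha = classify (h≡c a)
            where
              classify : (r : Σ ℕ λ t → t < L × h a ≡ c t) → proj₁ r ≡ α ⊎ proj₁ r ≡ β
              classify (t , t< , ha≡ct) with t ≤? m
              ... | yes t≤m = only t t≤m (subst (E x) ha≡ct x~ha)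
              ... | no t≰m = ⊥-elim (none t t< (≰⇒> t≰m , t< , subst (E x) ha≡ct x~ha))
          apart : ∀ {a a'} → a ≢ a' → position a ≢ position a'
          apart {a} {a'} a≢a' eq = a≢a' (h-inj a a' (trans (proj₂ (proj₂ (h≡c a)))
                                     (trans (cong c eq) (sym (proj₂ (proj₂ (h≡c a')))))))

      γ = proj₁ beyond-S
      m<γ = proj₁ (proj₂ beyond-S)
      γ<L = proj₁ (proj₂ (proj₂ beyond-S))
      x~cγ = proj₂ (proj₂ (proj₂ beyond-S))

      -- Otherwise the sector T would be S itself, or the complementary path through c γ.
      ¬ends : ¬ (α ≡ 0 × β ≡ m)
      ¬ends (α≡0 , β≡m) with pos≡c (SubPath.start T)
      ... | τ , τ< , shift = ends (only t₀ t₀≤m x~ct₀) (only t₁ t₁≤m x~ct₁)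
        where
          mT = SubPath.m T
          τ≡t₀ : τ ≡ t₀
          τ≡t₀ = trans (sym (+-identityʳ τ)) (c-inj (τ + 0) t₀ (subst (_< L) (sym (+-identityʳ τ)) τ<) (≤m⇒<L t₀≤m)
                   (trans (sym (shift 0)) (sym ct₀≡first)))
          c[τ+mT]≡ct₁ : c (τ + mT) ≡ c t₁
          c[τ+mT]≡ct₁ = trans (sym (shift mT)) (sym ct₁≡last)
          T-is-S : τ ≡ 0 → t₁ ≡ m → ⊥
          T-is-S τ≡0 t₁≡m with S⊄T
          ... | v , (t , t≤m , ct≡v) , v∉T = v∉T (t , ≤-trans t≤m (≤-reflexive (sym mT≡m)) ,
                                               trans (trans (shift t) (cong (λ u → c (u + t)) τ≡0)) ct≡v)
            where
              mT≡m : mT ≡ m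
              mT≡m = trans (c-inj mT t₁ (SubPath.m<len T) (≤m⇒<L t₁≤m)
                       (subst (λ u → c (u + mT) ≡ c t₁) τ≡0 c[τ+mT]≡ct₁)) t₁≡m
          T-through-γ : τ ≡ m → t₁ ≡ 0 → ⊥
          T-through-γ τ≡m t₁≡0 = proj₂ (proj₂ T-sector) (γ ∸ m) (m<n⇒0<n∸m m<γ) γ∸m<mT (subst (E x) (sym cγ-on-T) x~cγ)
            where
              cγ-on-T : pos G hole (SubPath.start T) (γ ∸ m) ≡ c γ
              cγ-on-T = trans (shift (γ ∸ m)) (cong c (trans (cong (_+ (γ ∸ m)) τ≡m) (m+[n∸m]≡n (<⇒≤ m<γ))))
              τ+mT≡L : τ + mT ≡ L
              τ+mT≡L = c≡c0⇒≡L (τ + mT) (<-≤-trans (SubPath.m≥1 T) (m≤n+m mT τ)) (+-mono-< τ< (SubPath.m<len T))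
                         (trans c[τ+mT]≡ct₁ (cong c t₁≡0))
              γ∸m<mT : γ ∸ m < mT
              γ∸m<mT = +-cancelˡ-< m (γ ∸ m) mT
                         (subst₂ _<_ (sym (m+[n∸m]≡n (<⇒≤ m<γ))) (trans (sym τ+mT≡L) (cong (_+ mT) τ≡m)) γ<L)
          ends : (t₀ ≡ α ⊎ t₀ ≡ β) → (t₁ ≡ α ⊎ t₁ ≡ β) → ⊥
          ends (inj₁ t₀≡α) (inj₁ t₁≡α) = t₀≢t₁ (trans t₀≡α (sym t₁≡α))
          ends (inj₂ t₀≡β) (inj₂ t₁≡β) = t₀≢t₁ (trans t₀≡β (sym t₁≡β))
          ends (inj₁ t₀≡α) (inj₂ t₁≡β) = T-is-S (trans τ≡t₀ (trans t₀≡α α≡0)) (trans t₁≡β β≡m)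
          ends (inj₂ t₀≡β) (inj₁ t₁≡α) = T-through-γ (trans τ≡t₀ (trans t₀≡β β≡m)) (trans t₁≡α α≡0)

      open AppendixPath P

      q≢c : ∀ j s → q j ≢ c s
      q≢c j s = p-offH (clamp k' j) (idx s)

      x~q-once : ∀ j j' → j ≤ k' → j' ≤ k' → E x (q j) → E x (q j') → j ≡ j'
      x~q-once j j' j≤ j'≤ e e' = clamp-inj k' j j' j≤ j'≤ (proj₂ wa _ _ e e')

      with-appendix : (r : ℕ → Fin n) → IsChordlessPath r k' → (∀ j s → r j ≢ c s) →
        (∀ s j → j ≤ k' → E (c s) (r j) → (c s ≡ c m × j ≡ 0) ⊎ (c s ≡ c 0 × j ≡ k')) →
        E (c m) (r 0) → E (c 0) (r k') →
        (∀ j j' → j ≤ k' → j' ≤ k' → E x (r j) → E x (r j') → j ≡ j') → TwoOnSector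
      with-appendix r r-path r≢c c~r⇒ cm~r0 c0~rk' x~r-once = record
        { L = L ; c = c ; c-cycle = c-isCycle ; cL = cL ; m = m ; K = k' ; q = r ; q-path = r-path
        ; q≢c = λ j s _ _ → r≢c j s
        ; c~q⇒ = λ s j s< j≤ e → ⊎-map (λ (eq , j≡) → c-inj s m s< m<len eq , j≡)
                                        (λ (eq , j≡) → c-inj s 0 s< z<s eq , j≡) (c~r⇒ s j j≤ e)
        ; cm~q0 = cm~r0 ; c0~qK = c0~rk'
        ; x = x ; x≢c = λ s _ e → x∉H (idx s) (sym e) ; x~q-once = x~r-once
        ; α = α ; β = β ; γ = γ ; α<β = α<β ; β≤m = β≤m ; x~c⇒ = only ; x~cα = x~cα ; x~cβ = x~cβ
        ; ¬ends = ¬ends ; m<γ = m<γ ; γ<L = γ<L ; x~cγ = x~cγ }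

      oriented : SectorWrt G hole P S → TwoOnSector
      oriented (inj₁ (c0≡hi₁ , cm≡hi₂)) = with-appendix (λ j → q (k' ∸ j)) (reverse q-path) (λ j → q≢c (k' ∸ j))
        (λ s j j≤ e → [ (λ (k'∸j≡0 , idx≡i₁) → inj₂ (trans (cong h idx≡i₁) (sym c0≡hi₁) , m∸n≡0⇒n≡m j≤ k'∸j≡0)) ,
                        (λ (k'∸j≡k' , idx≡i₂) → inj₁ (trans (cong h idx≡i₂) (sym cm≡hi₂) , m∸n≡m⇒n≡0 j≤ k'∸j≡k')) ]′
                      (q~h⇒ends (k' ∸ j) (idx s) (m∸n≤m k' j) (E-sym e)))
        (subst (λ u → E u (q k')) (sym cm≡hi₂) (E-sym qk'~hi₂))
        (subst (λ u → E (c 0) (q u)) (sym (n∸n≡0 k')) (subst (λ u → E u (q 0)) (sym c0≡hi₁) (E-sym q0~hi₁)))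
        (λ j j' j≤ j'≤ e e' → ∸-cancelˡ-≡ j≤ j'≤ (x~q-once _ _ (m∸n≤m k' j) (m∸n≤m k' j') e e'))
      oriented (inj₂ (c0≡hi₂ , cm≡hi₁)) = with-appendix q q-path q≢c
        (λ s j j≤ e → [ (λ (j≡0 , idx≡i₁) → inj₁ (trans (cong h idx≡i₁) (sym cm≡hi₁) , j≡0)) ,
                        (λ (j≡k' , idx≡i₂) → inj₂ (trans (cong h idx≡i₂) (sym c0≡hi₂) , j≡k')) ]′
                      (q~h⇒ends j (idx s) j≤ (E-sym e)))
        (subst (λ u → E u (q 0)) (sym cm≡hi₁) (E-sym q0~hi₁))
        (subst (λ u → E u (q k')) (sym c0≡hi₂) (E-sym qk'~hi₂))
        x~q-once

    exactly-two⇒ISK4 : ∀ α β → α < β → β ≤ m → Nb α → Nb β → (∀ s → s ≤ m → Nb s → s ≡ α ⊎ s ≡ β) → ISK4 G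
    exactly-two⇒ISK4 α β α<β β≤m x~cα x~cβ only =
      twoOnSector⇒ISK4 (ExactlyTwo.oriented α β α<β β≤m x~cα x~cβ only sw)

    open BoundedSearch

    first-neighbour : Σ ℕ λ α → α ≤ m × Nb α × (∀ t → t < α → ¬ Nb t)
    first-neighbour with least Nb Nb? (suc m)
    ... | inj₁ (α , α< , x~cα , before) = α , ≤-pred α< , x~cα , before
    ... | inj₂ none = ⊥-elim (none t₀ (s≤s t₀≤m) x~ct₀)

    next-neighbour : ∀ u → u ≤ m → Nb u → (Σ ℕ λ v → Consecutive u v) ⊎ (∀ t → u < t → t ≤ m → ¬ Nb t)
    next-neighbour u u≤m x~cu with least (λ t → u < t × Nb t) (λ t → (u <? t) ×-dec Nb? t) (suc m)
    ... | inj₁ (v , v< , (u<v , x~cv) , before) =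
          inj₁ (v , u<v , ≤-pred v< , x~cu , x~cv , λ t u<t t<v x~ct → before t t<v (u<t , x~ct))
    ... | inj₂ none = inj₂ (λ t u<t t≤m x~ct → none t (s≤s t≤m) (u<t , x~ct))

    only-two : ∀ {α β} → (∀ t → t < α → ¬ Nb t) → Consecutive α β → (∀ t → β < t → t ≤ m → ¬ Nb t) →
               ∀ s → s ≤ m → Nb s → s ≡ α ⊎ s ≡ β
    only-two {α} {β} before (α<β , _ , _ , _ , between) after s s≤m x~cs with <-cmp s α | <-cmp s β
    ... | tri< s<α _ _ | _ = ⊥-elim (before s s<α x~cs)
    ... | tri≈ _ s≡α _ | _ = inj₁ s≡α
    ... | tri> _ _ _   | tri≈ _ s≡β _ = inj₂ s≡β
    ... | tri> _ _ α<s | tri< s<β _ _ = ⊥-elim (between s α<s s<β x~cs)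
    ... | tri> _ _ _   | tri> _ _ β<s = ⊥-elim (after s β<s s≤m x~cs)

    three-consecutive-neighbours : ISK4-free G → Σ ℕ λ α → Σ ℕ λ β → Σ ℕ λ γ → Consecutive α β × Consecutive β γ
    three-consecutive-neighbours free with first-neighbour
    ... | α , α≤m , x~cα , before with next-neighbour α α≤m x~cα
    ...   | inj₂ after-α = ⊥-elim (t₀≢t₁ (trans (is-α t₀ t₀≤m x~ct₀) (sym (is-α t₁ t₁≤m x~ct₁))))
      where
        is-α : ∀ t → t ≤ m → Nb t → t ≡ α
        is-α t t≤m x~ct with <-cmp t α
        ... | tri< t<α _ _ = ⊥-elim (before t t<α x~ct)
        ... | tri≈ _ t≡α _ = t≡α
        ... | tri> _ _ α<t = ⊥-elim (after-α t α<t t≤m x~ct)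
    ...   | inj₁ (β , αβ@(α<β , β≤m , _ , x~cβ , _)) with next-neighbour β β≤m x~cβ
    ...     | inj₁ (γ , βγ) = α , β , γ , αβ , βγ
    ...     | inj₂ after-β = ⊥-elim (free (exactly-two⇒ISK4 α β α<β β≤m x~cα x~cβ (only-two before αβ after-β)))

    three-neighbours : ∀ {α β γ} → Consecutive α β → Consecutive β γ →
      ∃[ v₁ ] ∃[ v₂ ] ∃[ v₃ ] (v₁ ≢ v₂ × v₁ ≢ v₃ × v₂ ≢ v₃ ×
        InSub G hole S v₁ × InSub G hole S v₂ × InSub G hole S v₃ × E x v₁ × E x v₂ × E x v₃)
    three-neighbours {α} {β} {γ} (α<β , β≤m , x~cα , x~cβ , _) (β<γ , γ≤m , _ , x~cγ , _) =
      c α , c β , c γ ,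
      c-injective-on-S α<β β≤m , c-injective-on-S (<-trans α<β β<γ) γ≤m , c-injective-on-S β<γ γ≤m ,
      (α , ≤-trans (<⇒≤ α<β) β≤m , refl) , (β , β≤m , refl) , (γ , γ≤m , refl) , x~cα , x~cβ , x~cγ

    two-sectors : ∀ {α β γ} → Consecutive α β → Consecutive β γ →
      ∃[ T₁ ] ∃[ T₂ ] (IsSector G W T₁ × IsSector G W T₂ × SubPath.start T₁ ≢ SubPath.start T₂ ×
        _⊆ₛ_ G hole T₁ S × _⊆ₛ_ G hole T₂ S)
    two-sectors αβ@(α<β , β≤m , _) βγ with sector-between αβ | sector-between βγ
    ... | T₁ , T₁-sector , T₁⊆S , start₁ | T₂ , T₂-sector , T₂⊆S , start₂ =
      T₁ , T₂ , T₁-sector , T₂-sector ,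
      (λ eq → c-injective-on-S α<β β≤m (cong h (trans (sym start₁) (trans eq start₂)))) , T₁⊆S , T₂⊆S

lemma3p3 : (G : Graph) → ISK4-free G →
    (W : Wheel G) (P : Appendix G (Wheel.hole W)) → IsWheelAppendix G W P →
    (S : SubPath G (Wheel.hole W)) → SectorWrt G (Wheel.hole W) P S →
    (∃[ v₁ ] ∃[ v₂ ] ∃[ v₃ ]
       (v₁ ≢ v₂ × v₁ ≢ v₃ × v₂ ≢ v₃ ×
        InSub G (Wheel.hole W) S v₁ × InSub G (Wheel.hole W) S v₂ × InSub G (Wheel.hole W) S v₃ ×
        Graph.E G (Wheel.x W) v₁ × Graph.E G (Wheel.x W) v₂ × Graph.E G (Wheel.x W) v₃))
    ×
    (∃[ T₁ ] ∃[ T₂ ]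
       (IsSector G W T₁ × IsSector G W T₂ ×
        SubPath.start T₁ ≢ SubPath.start T₂ ×
        _⊆ₛ_ G (Wheel.hole W) T₁ S × _⊆ₛ_ G (Wheel.hole W) T₂ S))
lemma3p3 G free W P wa S sw with SectorOfAppendix.three-consecutive-neighbours G W P wa S sw free
... | _ , _ , _ , αβ , βγ = three-neighbours αβ βγ , two-sectors αβ βγ
  where open SectorOfAppendix G W P wa S sw
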